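{- Let $\ell\geq3$ and let $\Gamma$ be an $n$-vertex (simple) graph. Suppose $\Gamma$ contains $k$ copies of $T_\ell$ (as subgraphs) and $m$ edges, all of which are pairwise vertex disjoint. Then \[ \mathrm{mis}(\Gamma) \leq \left(\frac{31}{32}\right)^{k}2^{3(m+\ell k)-n}3^{n-2(m+\ell k)}. \]
   Context: $T_\ell$ denotes the graph consisting of two vertex-disjoint cycles $u_1u_2\cdots u_\ell$ and $v_1v_2\cdots v_\ell$ together with the perfect matching $u_iv_i$, $1\le i\le \ell$, between them. $\mathrm{mis}(\Gamma)$ denotes the number of maximal (with respect to inclusion) independent sets of $\Gamma$. -}

module Defs where

open import Data.Nat using (ℕ; zero; suc)
open import Data.Bool using (Bool; true; false)
open import Data.Bool.Properties using () renaming (_≟_ to _≟ᵇ_)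
open import Data.Fin using (Fin; toℕ)
open import Data.Fin.Properties using (all?)
open import Data.Fin.Subset using (Subset; _∈_; _⊆_; inside; outside)
open import Data.Fin.Subset.Properties using (_∈?_; _⊆?_; anySubset?)
open import Data.Vec using ([]; _∷_)
open import Data.Vec.Properties using (≡-dec)
open import Data.List using (List; []; _∷_; _++_; map; filter; length)
open import Data.Product using (Σ; _×_; _,_; ∃)
open import Data.Sum using (_⊎_; inj₁; inj₂)
open import Data.Empty using (⊥-elim)
open import Function using (_∘_)
open import Relation.Nullary using (Dec; yes; no; ¬_)
open import Relation.Nullary.Decidable using (_→-dec_; _×-dec_; ¬?; map′)
open import Relation.Binary.PropositionalEquality using (_≡_; _≢_; refl)

record Graph (n : ℕ) : Set where
  field
    adj     : Fin n → Fin n → Bool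
    adj-sym : ∀ i j → adj i j ≡ adj j i
    irrefl  : ∀ i → adj i i ≡ false

open Graph public

Adj : ∀ {n} → Graph n → Fin n → Fin n → Set
Adj G i j = adj G i j ≡ true

Independent : ∀ {n} → Graph n → Subset n → Set
Independent G S = ∀ i j → i ∈ S → j ∈ S → adj G i j ≡ false

MaximalIndependent : ∀ {n} → Graph n → Subset n → Set
MaximalIndependent G S =
  Independent G S × (∀ T → Independent G T → S ⊆ T → T ≡ S)

independent? : ∀ {n} (G : Graph n) (S : Subset n) → Dec (Independent G S)
independent? G S =
  all? λ i → all? λ j → (i ∈? S) →-dec ((j ∈? S) →-dec (adj G i j ≟ᵇ false))

maximalIndependent? : ∀ {n} (G : Graph n) (S : Subset n) →
                      Dec (MaximalIndependent G S)
maximalIndependent? {n} G S =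
  independent? G S ×-dec
  map′ to from (¬? (anySubset? λ T →
         independent? G T ×-dec (S ⊆? T ×-dec ¬? (≡-dec _≟ᵇ_ T S))))
  where
  to : ¬ ∃ (λ T → Independent G T × S ⊆ T × T ≢ S) →
       ∀ T → Independent G T → S ⊆ T → T ≡ S
  to h T iT sT with ≡-dec _≟ᵇ_ T S
  ... | yes eq = eq
  ... | no neq = ⊥-elim (h (T , iT , sT , neq))
  from : (∀ T → Independent G T → S ⊆ T → T ≡ S) →
         ¬ ∃ (λ T → Independent G T × S ⊆ T × T ≢ S)
  from h (T , iT , sT , neq) = neq (h T iT sT)

allSubsets : (n : ℕ) → List (Subset n)
allSubsets zero    = [] ∷ []
allSubsets (suc n) = map (inside ∷_) (allSubsets n) ++ map (outside ∷_) (allSubsets n)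

mis : ∀ {n} → Graph n → ℕ
mis G = length (filter (maximalIndependent? G) (allSubsets _))

-- The graph T_ℓ on vertex set Bool × Fin ℓ:
-- (false , i) = u_{i+1},  (true , i) = v_{i+1}.

CycNext : ∀ {ℓ} → Fin ℓ → Fin ℓ → Set
CycNext {ℓ} i j = (toℕ j ≡ suc (toℕ i)) ⊎ (suc (toℕ i) ≡ ℓ × toℕ j ≡ 0)

-- adjacency in T_ℓ: the two cycles plus the matching u_i v_i
TAdj : ∀ {ℓ} → Bool × Fin ℓ → Bool × Fin ℓ → Set
TAdj (a , i) (b , j) =
  (a ≡ b × (CycNext i j ⊎ CycNext j i)) ⊎ (a ≢ b × i ≡ j)

-- All used vertices are indexed by
--   (Fin k × (Bool × Fin ℓ)) ⊎ (Fin m × Bool)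
-- and the total vertex map is required to be injective; this encodes
-- both that each copy / edge is embedded injectively and that they are
-- pairwise vertex disjoint.

packVertex : ∀ {n ℓ k m : ℕ} → (Fin k → Bool × Fin ℓ → Fin n) → (Fin m → Bool → Fin n) →
             (Fin k × (Bool × Fin ℓ)) ⊎ (Fin m × Bool) → Fin n
packVertex copy edge (inj₁ (c , x)) = copy c x
packVertex copy edge (inj₂ (e , b)) = edge e b

record DisjointPacking {n : ℕ} (G : Graph n) (ℓ k m : ℕ) : Set where
  field
    copy     : Fin k → Bool × Fin ℓ → Fin n
    copy-hom : ∀ c x y → TAdj x y → Adj G (copy c x) (copy c y)
    edge     : Fin m → Bool → Fin n
    edge-adj : ∀ e → Adj G (edge e false) (edge e true)
    vertex-injective : ∀ p q → packVertex copy edge p ≡ packVertex copy edge q → p ≡ q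

{-# OPTIONS --safe #-}
module Submission where

-- Measure and conquer.  Let M be the matching formed by the m edges and the ℓ rungs u_i v_i of each
-- copy, f = |M| = m + ℓk.  For U ⊆ V(G) put
--   Φ(U) = 3^|U| 2^(n-|U|) · 8^(pairs of M inside U) 9^(other pairs) · 31^(copies inside U) 32^(other copies),
-- so that Φ(∅) = 2^n 9^f 32^k and Φ(V) = 3^n 8^f 31^k; we show mis(G[U]) · Φ(∅) ≤ Φ(U) by induction on U.
-- A maximal independent set S of G[U] either contains a vertex v, and then S − v is maximal
-- independent in G[U − N[v]], or avoids it; branching on a few vertices and bounding every leaf by
-- induction, it suffices that the ratios Φ(leaf)/Φ(U) sum to at most 1.  Deleting a vertex scales Φ by
-- 2/3 if it lies in no pair and no copy inside U, by at most 3/4 if it lies in no copy inside U, and by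
-- at most 24/31 always.  If some copy lies inside U, branching on the two ends of one rung gives total
-- ratio at most 30/31 or 928/961.  Otherwise Φ is 32^k times the matching potential, and a case analysis
-- on the degrees of exposed and matched vertices finishes, after an edge between two exposed vertices
-- has been added to the matching.

open import Defs
open import Data.Nat using (ℕ; zero; suc; _+_; _*_; _∸_; _^_; _≤_; _<_; z≤n; s≤s; NonZero; _≤ᵇ_)
open import Data.Nat.Properties
open import Data.Nat.Tactic.RingSolver using (solve-∀)
open import Data.Bool using (Bool; true; false; _∧_; _∨_; not; if_then_else_; T)
open import Data.Bool.Properties using (∧-zeroʳ; ∧-identityʳ; ∨-zeroʳ; ¬-not) renaming (_≟_ to _≟B_)
open import Data.Fin using (Fin; zero; suc; fromℕ; splitAt; join; remQuot; combine; _↑ʳ_)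
open import Data.Fin.Properties using (any?; all?; toℕ-fromℕ; splitAt-↑ʳ; remQuot-combine; join-splitAt; combine-remQuot) renaming (_≟_ to _≟F_; suc-injective to Fin-suc-injective)
open import Data.Fin.Subset using (inside; outside) renaming (_∈_ to _∈S_; _⊆_ to _⊆S_)
open import Data.Vec using (Vec; []; _∷_; lookup)
open import Data.Vec.Properties using ([]=⇒lookup; lookup⇒[]=)
open import Data.Vec.Functional using () renaming (_∷_ to _∷ᶠ_)
open import Data.List using (List; []; _∷_; _++_; map; filter; length)
open import Data.List.Properties using (map-++; map-∘)
open import Data.Nat.ListAction using (sum)
open import Data.Nat.ListAction.Properties using (sum-++)
open import Data.List.Membership.Propositional using (_∈_)
open import Data.List.Membership.Propositional.Properties using (∈-map⁺; ∈-map⁻)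
open import Data.List.Relation.Unary.Any as Any using (here; there)
open import Data.List.Relation.Unary.All as All using (All; []; _∷_)
open import Data.List.Relation.Unary.All.Properties.Core using (¬Any⇒All¬)
open import Data.Product using (Σ; _×_; _,_; ∃; proj₁; proj₂; uncurry)
open import Data.Sum using (_⊎_; inj₁; inj₂)
import Data.Sum as Sum
open import Data.Empty using (⊥; ⊥-elim)
open import Data.Unit using (⊤; tt)
open import Relation.Nullary using (Dec; yes; no; ¬_; does; ¬?)
open import Relation.Nullary.Decidable using (_×-dec_; _→-dec_; dec-true; dec-false)
open import Relation.Unary using (Decidable)
open import Relation.Binary.PropositionalEquality using (_≡_; _≢_; refl; sym; trans; cong; cong₂; subst; subst₂; ≢-sym; module ≡-Reasoning)
open import Function using (_∘_)

χ : Bool → ℕ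
χ true  = 1
χ false = 0

χ≤1 : ∀ b → χ b ≤ 1
χ≤1 true  = s≤s z≤n
χ≤1 false = z≤n

χ? : ∀ {p} {P : Set p} → Dec P → ℕ
χ? d = χ (does d)

χ?-mono : ∀ {p q} {P : Set p} {Q : Set q} → (P → Q) → (d : Dec P) (e : Dec Q) → χ? d ≤ χ? e
χ?-mono f (yes p) (yes q) = ≤-refl
χ?-mono f (yes p) (no ¬q) = ⊥-elim (¬q (f p))
χ?-mono f (no _)  e       = z≤n

χ?-weaken : ∀ {p q} {P : Set p} {Q : Set q} (d : Dec P) (e : Dec Q) (c : Bool) →
            (P → c ≡ true → Q) → χ? d * χ c ≤ χ? e
χ?-weaken (yes p) e true  f = subst (_≤ χ? e) (sym (*-identityʳ 1)) (χ?-mono (λ _ → f p refl) (yes p) e)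
χ?-weaken (yes p) e false f = z≤n
χ?-weaken (no _)  e c     f = z≤n

≤1-cases : ∀ x → x ≤ 1 → x ≡ 0 ⊎ x ≡ 1
≤1-cases zero          _         = inj₁ refl
≤1-cases (suc zero)    _         = inj₂ refl
≤1-cases (suc (suc x)) (s≤s ())

≢true⇒≡false : ∀ {b} → b ≢ true → b ≡ false
≢true⇒≡false = ¬-not

∧-true-l : ∀ {a b} → a ∧ b ≡ true → a ≡ true
∧-true-l {true} e = refl

∧-true-r : ∀ {a b} → a ∧ b ≡ true → b ≡ true
∧-true-r {true} e = e

∧-true : ∀ {a b} → a ≡ true → b ≡ true → a ∧ b ≡ true
∧-true refl refl = refl

not-true : ∀ {a} → not a ≡ true → a ≡ false
not-true {false} e = refl

not-false : ∀ {a} → a ≡ false → not a ≡ true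
not-false refl = refl

true≢false : true ≢ false
true≢false ()

eqb : ∀ {n} → Fin n → Fin n → Bool
eqb x y = does (x ≟F y)

eqb-refl : ∀ {n} (x : Fin n) → eqb x x ≡ true
eqb-refl x = dec-true (x ≟F x) refl

eqb-false : ∀ {n} {x y : Fin n} → x ≢ y → eqb x y ≡ false
eqb-false {x = x} {y} = dec-false (x ≟F y)

eqb-true⁻ : ∀ {n} {x y : Fin n} → eqb x y ≡ true → x ≡ y
eqb-true⁻ {x = x} {y} e with x ≟F y
... | yes p = p

eqb-false⁻ : ∀ {n} {x y : Fin n} → eqb x y ≡ false → x ≢ y
eqb-false⁻ {x = x} e refl = true≢false (trans (sym (eqb-refl x)) e)

eqb-sym : ∀ {n} (x y : Fin n) → eqb x y ≡ eqb y x
eqb-sym x y with x ≟F y | y ≟F x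
... | yes _ | yes _ = refl
... | no _  | no _  = refl
... | yes p | no q  = ⊥-elim (q (sym p))
... | no p  | yes q = ⊥-elim (p (sym q))

sumSubsets : ∀ n → (Vec Bool n → ℕ) → ℕ
sumSubsets zero    F = F []
sumSubsets (suc n) F = sumSubsets n (λ s → F (true ∷ s)) + sumSubsets n (λ s → F (false ∷ s))

sumSubsets-mono : ∀ n {F H : Vec Bool n → ℕ} → (∀ s → F s ≤ H s) → sumSubsets n F ≤ sumSubsets n H
sumSubsets-mono zero    h = h []
sumSubsets-mono (suc n) h =
  +-mono-≤ (sumSubsets-mono n (λ s → h (true ∷ s))) (sumSubsets-mono n (λ s → h (false ∷ s)))

sumSubsets-cong : ∀ n {F H : Vec Bool n → ℕ} → (∀ s → F s ≡ H s) → sumSubsets n F ≡ sumSubsets n H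
sumSubsets-cong zero    h = h []
sumSubsets-cong (suc n) h =
  cong₂ _+_ (sumSubsets-cong n (λ s → h (true ∷ s))) (sumSubsets-cong n (λ s → h (false ∷ s)))

sumSubsets-+ : ∀ n (F H : Vec Bool n → ℕ) →
               sumSubsets n (λ s → F s + H s) ≡ sumSubsets n F + sumSubsets n H
sumSubsets-+ zero    F H = refl
sumSubsets-+ (suc n) F H
  rewrite sumSubsets-+ n (λ s → F (true ∷ s)) (λ s → H (true ∷ s))
        | sumSubsets-+ n (λ s → F (false ∷ s)) (λ s → H (false ∷ s)) =
  +-exchange (sumSubsets n (λ s → F (true ∷ s))) (sumSubsets n (λ s → H (true ∷ s)))
             (sumSubsets n (λ s → F (false ∷ s))) (sumSubsets n (λ s → H (false ∷ s)))
  where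
  +-exchange : ∀ a b c d → a + b + (c + d) ≡ a + c + (b + d)
  +-exchange = solve-∀

sumSubsets-zero : ∀ n (F : Vec Bool n → ℕ) → (∀ s → F s ≡ 0) → sumSubsets n F ≡ 0
sumSubsets-zero zero    F h = h []
sumSubsets-zero (suc n) F h
  rewrite sumSubsets-zero n _ (λ s → h (true ∷ s)) | sumSubsets-zero n _ (λ s → h (false ∷ s)) = refl

flipAt : ∀ {n} → Fin n → Vec Bool n → Vec Bool n
flipAt zero    (b ∷ s) = not b ∷ s
flipAt (suc i) (b ∷ s) = b ∷ flipAt i s

lookup-flipAt-same : ∀ {n} (w : Fin n) (s : Vec Bool n) → lookup (flipAt w s) w ≡ not (lookup s w)
lookup-flipAt-same zero    (b ∷ s) = refl
lookup-flipAt-same (suc w) (b ∷ s) = lookup-flipAt-same w s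

lookup-flipAt-other : ∀ {n} (w z : Fin n) (s : Vec Bool n) → z ≢ w → lookup (flipAt w s) z ≡ lookup s z
lookup-flipAt-other zero    zero    s       ne = ⊥-elim (ne refl)
lookup-flipAt-other zero    (suc z) (b ∷ s) ne = refl
lookup-flipAt-other (suc w) zero    (b ∷ s) ne = refl
lookup-flipAt-other (suc w) (suc z) (b ∷ s) ne = lookup-flipAt-other w z s (ne ∘ cong suc)

sumSubsets-flipAt : ∀ n (w : Fin n) (F : Vec Bool n → ℕ) →
                    sumSubsets n F ≡ sumSubsets n (λ s → F (flipAt w s))
sumSubsets-flipAt (suc n) zero    F = +-comm (sumSubsets n (λ s → F (true ∷ s))) _
sumSubsets-flipAt (suc n) (suc w) F =
  cong₂ _+_ (sumSubsets-flipAt n w (λ s → F (true ∷ s))) (sumSubsets-flipAt n w (λ s → F (false ∷ s)))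

sumSubsets-≤1 : ∀ n (F : Vec Bool n → ℕ) → (∀ s → F s ≤ 1) →
                (∀ s → 1 ≤ F s → ∀ z → lookup s z ≡ false) → sumSubsets n F ≤ 1
sumSubsets-≤1 zero    F ≤1 supp = ≤1 []
sumSubsets-≤1 (suc n) F ≤1 supp = begin
  sumSubsets n (λ s → F (true ∷ s)) + sumSubsets n (λ s → F (false ∷ s))
    ≡⟨ cong (_+ sumSubsets n (λ s → F (false ∷ s))) (sumSubsets-zero n _ (λ s → vanishes s (F (true ∷ s)) refl)) ⟩
  sumSubsets n (λ s → F (false ∷ s))
    ≤⟨ sumSubsets-≤1 n _ (λ s → ≤1 (false ∷ s)) (λ s le z → supp (false ∷ s) le (suc z)) ⟩
  1 ∎
  where
  open ≤-Reasoning
  vanishes : ∀ s k → F (true ∷ s) ≡ k → k ≡ 0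
  vanishes s zero    e = refl
  vanishes s (suc k) e with () ← supp (true ∷ s) (subst (1 ≤_) (sym e) (s≤s z≤n)) zero

sum-map-allSubsets : ∀ n (F : Vec Bool n → ℕ) → sum (map F (allSubsets n)) ≡ sumSubsets n F
sum-map-allSubsets zero    F = +-identityʳ (F [])
sum-map-allSubsets (suc n) F = begin
  sum (map F (map (inside ∷_) xs ++ map (outside ∷_) xs))
    ≡⟨ cong sum (map-++ F (map (inside ∷_) xs) _) ⟩
  sum (map F (map (inside ∷_) xs) ++ map F (map (outside ∷_) xs))
    ≡⟨ sum-++ (map F (map (inside ∷_) xs)) _ ⟩
  sum (map F (map (inside ∷_) xs)) + sum (map F (map (outside ∷_) xs))
    ≡⟨ cong₂ _+_ (cong sum (sym (map-∘ xs))) (cong sum (sym (map-∘ xs))) ⟩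
  sum (map (F ∘ (inside ∷_)) xs) + sum (map (F ∘ (outside ∷_)) xs)
    ≡⟨ cong₂ _+_ (sum-map-allSubsets n _) (sum-map-allSubsets n _) ⟩
  sumSubsets (suc n) F ∎
  where
  open ≡-Reasoning
  xs = allSubsets n

length-filter≡sum : ∀ {A : Set} {P : A → Set} (P? : Decidable P) xs →
                    length (filter P? xs) ≡ sum (map (χ? ∘ P?) xs)
length-filter≡sum P? [] = refl
length-filter≡sum P? (x ∷ xs) with P? x
... | yes _ = cong suc (length-filter≡sum P? xs)
... | no _  = length-filter≡sum P? xs

sumFin : ∀ n → (Fin n → ℕ) → ℕ
sumFin zero    g = 0
sumFin (suc n) g = g zero + sumFin n (g ∘ suc)

prodFin : ∀ n → (Fin n → ℕ) → ℕ
prodFin zero    g = 1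
prodFin (suc n) g = g zero * prodFin n (g ∘ suc)

sumFin-cong : ∀ n {g h : Fin n → ℕ} → (∀ i → g i ≡ h i) → sumFin n g ≡ sumFin n h
sumFin-cong zero    e = refl
sumFin-cong (suc n) e = cong₂ _+_ (e zero) (sumFin-cong n (e ∘ suc))

prodFin-cong : ∀ n {g h : Fin n → ℕ} → (∀ i → g i ≡ h i) → prodFin n g ≡ prodFin n h
prodFin-cong zero    e = refl
prodFin-cong (suc n) e = cong₂ _*_ (e zero) (prodFin-cong n (e ∘ suc))

sumFin-mono : ∀ n {g h : Fin n → ℕ} → (∀ i → g i ≤ h i) → sumFin n g ≤ sumFin n h
sumFin-mono zero    e = ≤-refl
sumFin-mono (suc n) e = +-mono-≤ (e zero) (sumFin-mono n (e ∘ suc))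

sumFin-mono-< : ∀ n {g h : Fin n → ℕ} (x : Fin n) → (∀ i → g i ≤ h i) → g x < h x → sumFin n g < sumFin n h
sumFin-mono-< (suc n) zero    le lt = +-mono-<-≤ lt (sumFin-mono n (le ∘ suc))
sumFin-mono-< (suc n) (suc x) le lt = +-mono-≤-< (le zero) (sumFin-mono-< n x (le ∘ suc) lt)

sumFin-zero : ∀ n {g : Fin n → ℕ} → (∀ i → g i ≡ 0) → sumFin n g ≡ 0
sumFin-zero zero    e = refl
sumFin-zero (suc n) e rewrite e zero = sumFin-zero n (e ∘ suc)

sumFin-const : ∀ n c → sumFin n (λ _ → c) ≡ n * c
sumFin-const zero    c = refl
sumFin-const (suc n) c = cong (c +_) (sumFin-const n c)

prodFin-const : ∀ n c → prodFin n (λ _ → c) ≡ c ^ n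
prodFin-const zero    c = refl
prodFin-const (suc n) c = cong (c *_) (prodFin-const n c)

sumFin-χ-≤1 : ∀ k (P : Fin k → Bool) → (∀ i j → P i ≡ true → P j ≡ true → i ≡ j) →
              sumFin k (χ ∘ P) ≤ 1
sumFin-χ-≤1 zero    P uniq = z≤n
sumFin-χ-≤1 (suc k) P uniq with P zero in eq
... | true  = ≤-reflexive (cong suc (sumFin-zero k vanishes))
  where
  vanishes : ∀ i → χ (P (suc i)) ≡ 0
  vanishes i with P (suc i) in eq′
  ... | true  with () ← uniq zero (suc i) eq eq′
  ... | false = refl
... | false = sumFin-χ-≤1 k (P ∘ suc) (λ i j p q → Fin-suc-injective (uniq (suc i) (suc j) p q))

prodFin-pow : ∀ n (g c : Fin n → ℕ) a → prodFin n (λ i → g i * a ^ c i) ≡ prodFin n g * a ^ sumFin n c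
prodFin-pow zero    g c a = refl
prodFin-pow (suc n) g c a
  rewrite prodFin-pow n (g ∘ suc) (c ∘ suc) a | ^-distribˡ-+-* a (c zero) (sumFin n (c ∘ suc)) =
  interchange (g zero) (a ^ c zero) (prodFin n (g ∘ suc)) (a ^ sumFin n (c ∘ suc))
  where
  interchange : ∀ p q r s → p * q * (r * s) ≡ p * r * (q * s)
  interchange = solve-∀

prodFin-update : ∀ n (g h : Fin n → ℕ) (x : Fin n) → (∀ z → z ≢ x → g z ≡ h z) →
                 prodFin n g * h x ≡ prodFin n h * g x
prodFin-update (suc n) g h zero agree
  rewrite prodFin-cong n {g ∘ suc} {h ∘ suc} (λ i → agree (suc i) (λ ())) =
  swap (g zero) (prodFin n (h ∘ suc)) (h zero)
  where
  swap : ∀ p q r → p * q * r ≡ r * q * p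
  swap = solve-∀
prodFin-update (suc n) g h (suc x) agree
  rewrite agree zero (λ ())
        | *-assoc (h zero) (prodFin n (g ∘ suc)) (h (suc x))
        | *-assoc (h zero) (prodFin n (h ∘ suc)) (g (suc x)) =
  cong (h zero *_) (prodFin-update n (g ∘ suc) (h ∘ suc) x (λ z ne → agree (suc z) (ne ∘ Fin-suc-injective)))

-- Every index leaving q (those with m i) trades a factor α for a factor β.
prodFin-if-update : ∀ k (q q′ m : Fin k → Bool) α β → (∀ i → q′ i ≡ q i ∧ not (m i)) →
  prodFin k (λ i → if q′ i then α else β) * α ^ sumFin k (λ i → χ (q i ∧ m i))
  ≡ prodFin k (λ i → if q i then α else β) * β ^ sumFin k (λ i → χ (q i ∧ m i))
prodFin-if-update k q q′ m α β e =
  trans (sym (prodFin-pow k _ _ α)) (trans (prodFin-cong k pointwise) (prodFin-pow k _ _ β))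
  where
  pointwise : ∀ i → (if q′ i then α else β) * α ^ χ (q i ∧ m i) ≡ (if q i then α else β) * β ^ χ (q i ∧ m i)
  pointwise i rewrite e i with q i | m i
  ... | true  | true  = trans (*-comm β (α * 1)) (trans (cong (_* β) (*-identityʳ α)) (cong (α *_) (sym (*-identityʳ β))))
  ... | true  | false = refl
  ... | false | _     = refl

anyFin : ∀ k → (Fin k → Bool) → Bool
anyFin zero    g = false
anyFin (suc k) g = g zero ∨ anyFin k (g ∘ suc)

allFin : ∀ k → (Fin k → Bool) → Bool
allFin zero    g = true
allFin (suc k) g = g zero ∧ allFin k (g ∘ suc)

anyFin-false : ∀ k (g : Fin k → Bool) → (∀ i → g i ≡ false) → anyFin k g ≡ false
anyFin-false zero    g h = refl
anyFin-false (suc k) g h rewrite h zero = anyFin-false k _ (h ∘ suc)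

anyFin-true : ∀ k (g : Fin k → Bool) i → g i ≡ true → anyFin k g ≡ true
anyFin-true (suc k) g zero    e rewrite e = refl
anyFin-true (suc k) g (suc i) e with g zero
... | true  = refl
... | false = anyFin-true k _ i e

anyFin-true⁻ : ∀ k (g : Fin k → Bool) → anyFin k g ≡ true → Σ (Fin k) λ i → g i ≡ true
anyFin-true⁻ (suc k) g e with g zero in e0
... | true  = zero , e0
... | false with anyFin-true⁻ k _ e
...   | i , ei = suc i , ei

allFin-true⁻ : ∀ k (g : Fin k → Bool) → allFin k g ≡ true → ∀ i → g i ≡ true
allFin-true⁻ (suc k) g e zero    = ∧-true-l e
allFin-true⁻ (suc k) g e (suc i) = allFin-true⁻ k _ (∧-true-r {g zero} e) i

allFin-true : ∀ k (g : Fin k → Bool) → (∀ i → g i ≡ true) → allFin k g ≡ true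
allFin-true zero    g h = refl
allFin-true (suc k) g h rewrite h zero = allFin-true k _ (h ∘ suc)

allFin-cong : ∀ k {g h : Fin k → Bool} → (∀ i → g i ≡ h i) → allFin k g ≡ allFin k h
allFin-cong zero    e = refl
allFin-cong (suc k) e = cong₂ _∧_ (e zero) (allFin-cong k (e ∘ suc))

allFin-∧-not : ∀ k (p q : Fin k → Bool) →
               allFin k (λ i → p i ∧ not (q i)) ≡ allFin k p ∧ not (anyFin k q)
allFin-∧-not zero    p q = refl
allFin-∧-not (suc k) p q rewrite allFin-∧-not k (p ∘ suc) (q ∘ suc) with p zero | q zero
... | true  | true  = sym (∧-zeroʳ (allFin k (p ∘ suc)))
... | true  | false = refl
... | false | _     = refl

ratio-from-eq : ∀ x y a b c d .{{_ : NonZero a}} → x * a ≡ y * b → c * b ≤ d * a → c * x ≤ d * y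
ratio-from-eq x y a b c d eq le = *-cancelˡ-≤ a (begin
  a * (c * x)  ≡⟨ shuffle₁ a c x ⟩
  c * (x * a)  ≡⟨ cong (c *_) eq ⟩
  c * (y * b)  ≡⟨ shuffle₂ c y b ⟩
  (c * b) * y  ≤⟨ *-monoˡ-≤ y le ⟩
  (d * a) * y  ≡⟨ shuffle₃ d a y ⟩
  a * (d * y)  ∎)
  where
  open ≤-Reasoning
  shuffle₁ : ∀ a c x → a * (c * x) ≡ c * (x * a)
  shuffle₁ = solve-∀
  shuffle₂ : ∀ c y b → c * (y * b) ≡ (c * b) * y
  shuffle₂ = solve-∀
  shuffle₃ : ∀ d a y → (d * a) * y ≡ a * (d * y)
  shuffle₃ = solve-∀

VSet : ℕ → Set
VSet n = Fin n → Bool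

module Ratios {n : ℕ} (Ψ : VSet n → ℕ) where

  record Ratio≤ (N D : ℕ) (V W : VSet n) : Set where
    constructor mkR
    field unR : D * Ψ V ≤ N * Ψ W

  infixr 5 _⨾_

  _⨾_ : ∀ {N₁ D₁ N₂ D₂ U V W} → Ratio≤ N₁ D₁ U V → Ratio≤ N₂ D₂ V W → Ratio≤ (N₁ * N₂) (D₁ * D₂) U W
  _⨾_ {N₁} {D₁} {N₂} {D₂} {U} {V} {W} (mkR r₁) (mkR r₂) = mkR (begin
    D₁ * D₂ * Ψ U    ≡⟨ swap₁ D₁ D₂ (Ψ U) ⟩
    D₂ * (D₁ * Ψ U)  ≤⟨ *-monoʳ-≤ D₂ r₁ ⟩
    D₂ * (N₁ * Ψ V)  ≡⟨ swap₂ D₂ N₁ (Ψ V) ⟩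
    N₁ * (D₂ * Ψ V)  ≤⟨ *-monoʳ-≤ N₁ r₂ ⟩
    N₁ * (N₂ * Ψ W)  ≡⟨ *-assoc N₁ N₂ (Ψ W) ⟨
    N₁ * N₂ * Ψ W    ∎)
    where
    open ≤-Reasoning
    swap₁ : ∀ p q r → p * q * r ≡ q * (p * r)
    swap₁ = solve-∀
    swap₂ : ∀ p q r → p * (q * r) ≡ q * (p * r)
    swap₂ = solve-∀

  weaken : ∀ {N D N′ D′ V W} → .{{_ : NonZero D}} → Ratio≤ N D V W → N * D′ ≤ N′ * D → Ratio≤ N′ D′ V W
  weaken {N} {D} {N′} {D′} {V} {W} (mkR r) le = mkR (*-cancelˡ-≤ D (begin
    D * (D′ * Ψ V)  ≡⟨ swap₁ D D′ (Ψ V) ⟩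
    D′ * (D * Ψ V)  ≤⟨ *-monoʳ-≤ D′ r ⟩
    D′ * (N * Ψ W)  ≡⟨ swap₂ D′ N (Ψ W) ⟩
    N * D′ * Ψ W    ≤⟨ *-monoˡ-≤ (Ψ W) le ⟩
    N′ * D * Ψ W    ≡⟨ swap₃ N′ D (Ψ W) ⟩
    D * (N′ * Ψ W)  ∎))
    where
    open ≤-Reasoning
    swap₁ : ∀ p q r → p * (q * r) ≡ q * (p * r)
    swap₁ = solve-∀
    swap₂ : ∀ p q r → p * (q * r) ≡ q * p * r
    swap₂ = solve-∀
    swap₃ : ∀ p q r → p * q * r ≡ q * (p * r)
    swap₃ = solve-∀

  relax : ∀ {N D V W} N′ D′ .{{_ : NonZero D}} → Ratio≤ N D V W →
          {_ : T (N * D′ ≤ᵇ N′ * D)} → Ratio≤ N′ D′ V W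
  relax {N} {D} N′ D′ r {p} = weaken r (≤ᵇ⇒≤ (N * D′) (N′ * D) p)

module _ {n : ℕ} where

  list2 : Fin n → Fin n → List (Fin n)
  list2 y1 y2 = y2 ∷ y1 ∷ []
  list3 : Fin n → Fin n → Fin n → List (Fin n)
  list3 y1 y2 y3 = y3 ∷ y2 ∷ y1 ∷ []

  pick-1-of-2 : ∀ (y1 y2 p : Fin n) → y2 ≢ y1 → Σ (Fin n) λ r → r ∈ list2 y1 y2 × r ≢ p
  pick-1-of-2 y1 y2 p n21 with y1 ≟F p
  ... | yes refl = y2 , here refl , n21
  ... | no ne = y1 , there (here refl) , ne

  pick-2-of-3 : ∀ (y1 y2 y3 p : Fin n) → y2 ≢ y1 → y3 ≢ y2 → y3 ≢ y1 →
          Σ (Fin n) λ r1 → Σ (Fin n) λ r2 → r1 ∈ list3 y1 y2 y3 × r2 ∈ list3 y1 y2 y3 × r2 ≢ r1 × r1 ≢ p × r2 ≢ p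
  pick-2-of-3 y1 y2 y3 p n21 n32 n31 with y1 ≟F p
  ... | yes refl = y2 , y3 , there (here refl) , here refl , n32 , n21 , n31
  ... | no n1p with y2 ≟F p
  ...   | yes refl = y1 , y3 , there (there (here refl)) , here refl , n31 , n1p , n32
  ...   | no n2p = y1 , y2 , there (there (here refl)) , there (here refl) , n21 , n1p , n2p

  pick-1-of-3 : ∀ (y1 y2 y3 p q : Fin n) → y2 ≢ y1 → y3 ≢ y2 → y3 ≢ y1 →
          Σ (Fin n) λ r → r ∈ list3 y1 y2 y3 × r ≢ p × r ≢ q
  pick-1-of-3 y1 y2 y3 p q n21 n32 n31 with y3 ≟F p | y3 ≟F q
  ... | no a | no b = y3 , here refl , a , b
  ... | yes refl | _ with y1 ≟F q
  ...   | no c = y1 , there (there (here refl)) , (≢-sym n31) , c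
  ...   | yes refl = y2 , there (here refl) , (≢-sym n32) , n21
  pick-1-of-3 y1 y2 y3 p q n21 n32 n31 | no a | yes refl with y1 ≟F p
  ...   | no c = y1 , there (there (here refl)) , c , (≢-sym n31)
  ...   | yes refl = y2 , there (here refl) , n21 , (≢-sym n32)

  list4 : Fin n → Fin n → Fin n → Fin n → List (Fin n)
  list4 y1 y2 y3 y4 = y4 ∷ y3 ∷ y2 ∷ y1 ∷ []

  pick-3-of-4 : ∀ (y1 y2 y3 y4 p : Fin n) → y2 ≢ y1 → y3 ≢ y2 → y3 ≢ y1 → y4 ≢ y3 → y4 ≢ y2 → y4 ≢ y1 →
          Σ (Fin n) λ r1 → Σ (Fin n) λ r2 → Σ (Fin n) λ r3 →
          r1 ∈ list4 y1 y2 y3 y4 × r2 ∈ list4 y1 y2 y3 y4 × r3 ∈ list4 y1 y2 y3 y4 ×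
          r2 ≢ r1 × r3 ≢ r2 × r3 ≢ r1 × r1 ≢ p × r2 ≢ p × r3 ≢ p
  pick-3-of-4 y1 y2 y3 y4 p n21 n32 n31 n43 n42 n41 with y1 ≟F p
  ... | yes refl = y2 , y3 , y4 , there (there (here refl)) , there (here refl) , here refl , n32 , n43 , n42 , n21 , n31 , n41
  ... | no n1 with y2 ≟F p
  ...   | yes refl = y1 , y3 , y4 , there (there (there (here refl))) , there (here refl) , here refl , n31 , n43 , n41 , n1 , n32 , n42
  ...   | no n2 with y3 ≟F p
  ...     | yes refl = y1 , y2 , y4 , there (there (there (here refl))) , there (there (here refl)) , here refl , n21 , n42 , n41 , n1 , n2 , n43
  ...     | no n3 = y1 , y2 , y3 , there (there (there (here refl))) , there (there (here refl)) , there (here refl) , n21 , n32 , n31 , n1 , n2 , n3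

  split-3 : ∀ (y1 y2 y3 p : Fin n) → y2 ≢ y1 → y3 ≢ y2 → y3 ≢ y1 → p ∈ list3 y1 y2 y3 →
           Σ (Fin n) λ c1 → Σ (Fin n) λ c2 → c1 ∈ list3 y1 y2 y3 × c2 ∈ list3 y1 y2 y3 × c2 ≢ c1 × c1 ≢ p × c2 ≢ p ×
           (∀ {y} → y ∈ list3 y1 y2 y3 → y ∈ (c2 ∷ c1 ∷ p ∷ []))
  split-3 y1 y2 y3 p n21 n32 n31 (here refl) = y1 , y2 , there (there (here refl)) , there (here refl) , n21 , (≢-sym n31) , (≢-sym n32) , sub
    where sub : ∀ {y} → y ∈ list3 y1 y2 y3 → y ∈ (y2 ∷ y1 ∷ y3 ∷ [])
          sub (here e) = there (there (here e))
          sub (there (here e)) = here e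
          sub (there (there (here e))) = there (here e)
  split-3 y1 y2 y3 p n21 n32 n31 (there (here refl)) = y1 , y3 , there (there (here refl)) , here refl , n31 , (≢-sym n21) , n32 , sub
    where sub : ∀ {y} → y ∈ list3 y1 y2 y3 → y ∈ (y3 ∷ y1 ∷ y2 ∷ [])
          sub (here e) = here e
          sub (there (here e)) = there (there (here e))
          sub (there (there (here e))) = there (here e)
  split-3 y1 y2 y3 p n21 n32 n31 (there (there (here refl))) = y2 , y3 , there (here refl) , here refl , n32 , n21 , n31 , sub
    where sub : ∀ {y} → y ∈ list3 y1 y2 y3 → y ∈ (y3 ∷ y2 ∷ y1 ∷ [])
          sub (here e) = here e
          sub (there (here e)) = there (here e)
          sub (there (there (here e))) = there (there (here e))

module Bounds {n : ℕ} (Gr : Graph n) where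

  A : Fin n → Fin n → Bool
  A = adj Gr

  A-sym : ∀ x y → A x y ≡ A y x
  A-sym = adj-sym Gr

  A-sym-true : ∀ {x y} → A x y ≡ true → A y x ≡ true
  A-sym-true {x} {y} e = trans (A-sym y x) e

  A-≢ : ∀ {x y} → A x y ≡ true → x ≢ y
  A-≢ {x} e refl = true≢false (trans (sym e) (irrefl Gr x))

  A-≢′ : ∀ {x y} → A x y ≡ true → y ≢ x
  A-≢′ e = A-≢ e ∘ sym

  MIS : VSet n → VSet n → Set
  MIS U s = (∀ z → s z ≡ true → U z ≡ true)
          × (∀ x y → s x ≡ true → s y ≡ true → A x y ≡ false)
          × (∀ z → U z ≡ true → s z ≡ false → ∃ λ y → s y ≡ true × A z y ≡ true)

  MIS? : ∀ U s → Dec (MIS U s)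
  MIS? U s = all? (λ z → (s z ≟B true) →-dec (U z ≟B true))
      ×-dec all? (λ x → all? (λ y → (s x ≟B true) →-dec ((s y ≟B true) →-dec (A x y ≟B false))))
      ×-dec all? (λ z → (U z ≟B true) →-dec ((s z ≟B false) →-dec any? (λ y → (s y ≟B true) ×-dec (A z y ≟B true))))

  fullSet : VSet n
  fullSet _ = true

  _⊆_ : VSet n → VSet n → Set
  V ⊆ U = ∀ z → V z ≡ true → U z ≡ true

  ≢true-at : ∀ (V : VSet n) x → V x ≢ true → V x ≡ false
  ≢true-at V x = ≢true⇒≡false

  opaque
    del : Fin n → VSet n → VSet n
    del x U z = U z ∧ not (eqb z x)

    delNbhd : Fin n → VSet n → VSet n
    delNbhd w U z = U z ∧ not (A w z) ∧ not (eqb z w)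

  opaque
    unfolding del

    del-sub : ∀ {x U z} → del x U z ≡ true → U z ≡ true
    del-sub {x} {U} {z} e = ∧-true-l {U z} e

    del-≢ : ∀ {x U z} → del x U z ≡ true → z ≢ x
    del-≢ {x} {U} {z} e = eqb-false⁻ (not-true (∧-true-r {U z} e))

    del-intro : ∀ {x U z} → U z ≡ true → z ≢ x → del x U z ≡ true
    del-intro u ne = ∧-true u (not-false (eqb-false ne))

    del-self : ∀ x U → del x U x ≡ false
    del-self x U rewrite eqb-refl x = ∧-zeroʳ (U x)

    del-def : ∀ x U z → del x U z ≡ U z ∧ not (eqb z x)
    del-def x U z = refl

    del-other : ∀ {x U z} → z ≢ x → del x U z ≡ U z
    del-other {x} {U} {z} ne rewrite eqb-false ne = ∧-identityʳ (U z)

  opaque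
    unfolding delNbhd

    delNbhd-sub : ∀ {w U z} → delNbhd w U z ≡ true → U z ≡ true
    delNbhd-sub {w} {U} {z} e = ∧-true-l {U z} e

    delNbhd-nonadj : ∀ {w U z} → delNbhd w U z ≡ true → A w z ≡ false
    delNbhd-nonadj {w} {U} {z} e = not-true (∧-true-l {not (A w z)} (∧-true-r {U z} e))

    delNbhd-≢ : ∀ {w U z} → delNbhd w U z ≡ true → z ≢ w
    delNbhd-≢ {w} {U} {z} e = eqb-false⁻ (not-true (∧-true-r {not (A w z)} (∧-true-r {U z} e)))

    delNbhd-intro : ∀ {w U z} → U z ≡ true → A w z ≡ false → z ≢ w → delNbhd w U z ≡ true
    delNbhd-intro u a ne = ∧-true u (∧-true (not-false a) (not-false (eqb-false ne)))

  ⊆-trans : ∀ {U V W} → U ⊆ V → V ⊆ W → U ⊆ W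
  ⊆-trans a b z e = b z (a z e)

  del-absent : ∀ x U → U x ≡ false → ∀ z → del x U z ≡ U z
  del-absent x U ux z with z ≟F x
  ... | yes refl = trans (del-self x U) (sym ux)
  ... | no ne    = del-other ne

  del-⊆ : ∀ x U → del x U ⊆ U
  del-⊆ x U z = del-sub

  delAll : List (Fin n) → VSet n → VSet n
  delAll []       U = U
  delAll (x ∷ xs) U = del x (delAll xs U)

  delAll-sub : ∀ xs {U z} → delAll xs U z ≡ true → U z ≡ true
  delAll-sub []       e = e
  delAll-sub (x ∷ xs) e = delAll-sub xs (del-sub e)

  delAll-⊆ : ∀ xs {U} → delAll xs U ⊆ U
  delAll-⊆ xs z = delAll-sub xs

  delAll-∉ : ∀ xs {U z} → delAll xs U z ≡ true → ∀ {o} → o ∈ xs → z ≢ o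
  delAll-∉ (x ∷ xs) e (here refl) = del-≢ e
  delAll-∉ (x ∷ xs) e (there m)   = delAll-∉ xs (del-sub e) m

  delAll-intro : ∀ xs {U z} → U z ≡ true → (∀ {o} → o ∈ xs → z ≢ o) → delAll xs U z ≡ true
  delAll-intro []       u h = u
  delAll-intro (x ∷ xs) u h = del-intro (delAll-intro xs u (h ∘ there)) (h (here refl))

  delAll-⊆-del : ∀ y xs {U} → y ∈ xs → delAll xs U ⊆ del y U
  delAll-⊆-del y xs m z e = del-intro (delAll-sub xs e) (delAll-∉ xs e m)

  allIn : VSet n → List (Fin n) → Bool
  allIn s []       = true
  allIn s (x ∷ xs) = s x ∧ allIn s xs

  allOut : VSet n → List (Fin n) → Bool
  allOut s []       = true
  allOut s (x ∷ xs) = not (s x) ∧ allOut s xs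

  allOut-∈ : ∀ s xs → allOut s xs ≡ true → ∀ {o} → o ∈ xs → s o ≡ false
  allOut-∈ s (x ∷ xs) e (here refl) = not-true (∧-true-l {not (s x)} e)
  allOut-∈ s (x ∷ xs) e (there m)   = allOut-∈ s xs (∧-true-r {not (s x)} e) m

  respects : List (Fin n) → List (Fin n) → VSet n → Bool
  respects In Out s = allIn s In ∧ allOut s Out

  misWith : VSet n → List (Fin n) → List (Fin n) → ℕ
  misWith U In Out = sumSubsets n (λ S → χ? (MIS? U (lookup S)) * χ (respects In Out (lookup S)))

  misIn : VSet n → ℕ
  misIn U = misWith U [] []

  misWith-split : ∀ U In Out x → misWith U In Out ≡ misWith U (x ∷ In) Out + misWith U In (x ∷ Out)
  misWith-split U In Out x = trans
    (sumSubsets-cong n λ S → trans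
       (cong (χ? (MIS? U (lookup S)) *_) (χ-split (lookup S x) (allIn (lookup S) In) (allOut (lookup S) Out)))
       (*-distribˡ-+ (χ? (MIS? U (lookup S))) _ _))
    (sumSubsets-+ n _ _)
    where
    χ-split : ∀ l a b → χ (a ∧ b) ≡ χ ((l ∧ a) ∧ b) + χ (a ∧ (not l ∧ b))
    χ-split true  true  true  = refl
    χ-split true  true  false = refl
    χ-split true  false b     = refl
    χ-split false true  true  = refl
    χ-split false true  false = refl
    χ-split false false b     = refl

  MIS-delNbhd : ∀ U w Out s t → MIS U s → s w ≡ true → allOut s Out ≡ true →
                t w ≡ false → (∀ z → z ≢ w → t z ≡ s z) → MIS (delAll Out (delNbhd w U)) t
  MIS-delNbhd U w Out s t (sub , indep , dom) sw out tw agree = sub′ , indep′ , dom′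
    where
    from-s : ∀ z → t z ≡ true → s z ≡ true × z ≢ w
    from-s z e with z ≟F w
    ... | yes refl = ⊥-elim (true≢false (trans (sym e) tw))
    ... | no ne    = trans (sym (agree z ne)) e , ne
    sub′ : ∀ z → t z ≡ true → delAll Out (delNbhd w U) z ≡ true
    sub′ z e with from-s z e
    ... | sz , ne = delAll-intro Out (delNbhd-intro (sub z sz) (indep w z sw sz) ne)
                      (λ m eq → true≢false (trans (sym sz) (subst (λ q → s q ≡ false) (sym eq) (allOut-∈ s Out out m))))
    indep′ : ∀ x y → t x ≡ true → t y ≡ true → A x y ≡ false
    indep′ x y ex ey = indep x y (proj₁ (from-s x ex)) (proj₁ (from-s y ey))
    dom′ : ∀ z → delAll Out (delNbhd w U) z ≡ true → t z ≡ false → ∃ λ y → t y ≡ true × A z y ≡ true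
    dom′ z e tz with delAll-sub Out e
    ... | e′ with dom z (delNbhd-sub e′) (trans (sym (agree z (delNbhd-≢ e′))) tz)
    ...   | y , sy , azy with y ≟F w
    ...     | yes refl = ⊥-elim (true≢false (trans (sym (A-sym-true azy)) (delNbhd-nonadj e′)))
    ...     | no ne    = y , trans (agree y ne) sy , azy

  MIS-delAll : ∀ U Out s → MIS U s → allOut s Out ≡ true → MIS (delAll Out U) s
  MIS-delAll U Out s (sub , indep , dom) out = sub′ , indep , λ z e → dom z (delAll-sub Out e)
    where
    sub′ : ∀ z → s z ≡ true → delAll Out U z ≡ true
    sub′ z sz = delAll-intro Out (sub z sz) (λ m eq → true≢false (trans (sym sz) (subst (λ q → s q ≡ false) (sym eq) (allOut-∈ s Out out m))))

  MIS-dominates : ∀ U Out s v → MIS U s → allOut s Out ≡ true → U v ≡ true → v ∈ Out →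
                  (∀ y → U y ≡ true → A v y ≡ true → y ∈ Out) → ⊥
  MIS-dominates U Out s v (sub , indep , dom) out uv vo nb with dom v uv (allOut-∈ s Out out vo)
  ... | y , sy , avy = true≢false (trans (sym sy) (allOut-∈ s Out out (nb y (sub y sy) avy)))

  -- An MIS S of G[U] with w ∈ S becomes, after removing w, an MIS of G[U − N[w]]; the sum is
  -- reindexed by flipping the coordinate w.
  misWith-in≤ : ∀ U w Out → misWith U (w ∷ []) Out ≤ misIn (delAll Out (delNbhd w U))
  misWith-in≤ U w Out = subst (_≤ misIn (delAll Out (delNbhd w U))) (sym (sumSubsets-flipAt n w _))
    (sumSubsets-mono n λ T → subst (χ? (MIS? U (lookup (flipAt w T))) * χ (respects (w ∷ []) Out (lookup (flipAt w T))) ≤_)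
       (sym (*-identityʳ _))
       (χ?-weaken (MIS? U (lookup (flipAt w T))) (MIS? (delAll Out (delNbhd w U)) (lookup T)) _
         (λ m c → MIS-delNbhd U w Out (lookup (flipAt w T)) (lookup T) m
            (∧-true-l (∧-true-l c)) (∧-true-r c)
            (flipped T (∧-true-l (∧-true-l c)))
            (λ z ne → sym (lookup-flipAt-other w z T ne)))))
    where
    flipped : ∀ T → lookup (flipAt w T) w ≡ true → lookup T w ≡ false
    flipped T e = not-true (trans (sym (lookup-flipAt-same w T)) e)

  misWith-out≤ : ∀ U Out → misWith U [] Out ≤ misIn (delAll Out U)
  misWith-out≤ U Out = sumSubsets-mono n λ S →
    subst (χ? (MIS? U (lookup S)) * χ (respects [] Out (lookup S)) ≤_) (sym (*-identityʳ _))
      (χ?-weaken (MIS? U (lookup S)) (MIS? (delAll Out U) (lookup S)) _ (MIS-delAll U Out (lookup S)))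

  misWith-undominated : ∀ U In Out v → U v ≡ true → v ∈ Out → (∀ y → U y ≡ true → A v y ≡ true → y ∈ Out) →
                        misWith U In Out ≡ 0
  misWith-undominated U In Out v uv vo nb =
    sumSubsets-zero n _ λ S → vanishes S (MIS? U (lookup S)) (respects In Out (lookup S)) refl
    where
    vanishes : ∀ S (d : Dec (MIS U (lookup S))) c → c ≡ respects In Out (lookup S) → χ? d * χ c ≡ 0
    vanishes S (yes m) true  e = ⊥-elim (MIS-dominates U Out _ v m (∧-true-r {allIn (lookup S) In} (sym e)) uv vo nb)
    vanishes S (yes m) false e = refl
    vanishes S (no _)  c     e = refl

  misIn-empty≤1 : ∀ U → (∀ z → U z ≡ false) → misIn U ≤ 1
  misIn-empty≤1 U empty = sumSubsets-≤1 n _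
    (λ S → subst (_≤ 1) (sym (*-identityʳ _)) (χ≤1 (does (MIS? U (lookup S)))))
    (λ S le z → only-empty S (MIS? U (lookup S)) le z)
    where
    only-empty : ∀ S (d : Dec (MIS U (lookup S))) → 1 ≤ χ? d * 1 → ∀ z → lookup S z ≡ false
    only-empty S (yes (sub , _)) le z = ≢true-at (lookup S) z (λ e → true≢false (trans (sym (sub z e)) (empty z)))
    only-empty S (no _) ()



  absentees : ∀ {m} → (Fin m → Bool) → List (Fin m)
  absentees {zero}  V = []
  absentees {suc m} V with V zero
  ... | true  = map suc (absentees (V ∘ suc))
  ... | false = zero ∷ map suc (absentees (V ∘ suc))

  absentees-false : ∀ {m} (V : Fin m → Bool) {o} → o ∈ absentees V → V o ≡ false
  absentees-false {suc m} V mem with V zero in eq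
  absentees-false {suc m} V mem         | true with ∈-map⁻ suc mem
  ... | z , m′ , refl = absentees-false (V ∘ suc) m′
  absentees-false {suc m} V (here refl) | false = eq
  absentees-false {suc m} V (there mem) | false with ∈-map⁻ suc mem
  ... | z , m′ , refl = absentees-false (V ∘ suc) m′

  absentees-complete : ∀ {m} (V : Fin m → Bool) {z} → V z ≡ false → z ∈ absentees V
  absentees-complete {suc m} V {zero} e with V zero
  ... | false = here refl
  absentees-complete {suc m} V {suc z} e with V zero
  ... | true  = ∈-map⁺ suc (absentees-complete (V ∘ suc) e)
  ... | false = there (∈-map⁺ suc (absentees-complete (V ∘ suc) e))

  delAll-absentees : ∀ V U → V ⊆ U → ∀ z → delAll (absentees V) U z ≡ V z
  delAll-absentees V U s z with V z in eq
  ... | true  = delAll-intro (absentees V) (s z eq)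
                  (λ m e → true≢false (trans (sym eq) (subst (λ q → V q ≡ false) (sym e) (absentees-false V m))))
  ... | false = ≢true-at (delAll (absentees V) U) z
                  (λ e → delAll-∉ (absentees V) e (absentees-complete V eq) refl)

  ⊆-mono-by-del : (Ψ : VSet n → ℕ) → (∀ {V W} → (∀ z → V z ≡ W z) → Ψ V ≡ Ψ W) →
                  ∀ U → (∀ x W → W ⊆ U → Ψ (del x W) ≤ Ψ W) → ∀ V → V ⊆ U → Ψ V ≤ Ψ U
  ⊆-mono-by-del Ψ Ψ-cong U Ψ-del V V⊆U =
    subst (_≤ Ψ U) (Ψ-cong (delAll-absentees V U V⊆U)) (delAll-≤ (absentees V))
    where
    delAll-≤ : ∀ xs → Ψ (delAll xs U) ≤ Ψ U
    delAll-≤ []       = ≤-refl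
    delAll-≤ (x ∷ xs) = ≤-trans (Ψ-del x (delAll xs U) (delAll-⊆ xs)) (delAll-≤ xs)

  size : VSet n → ℕ
  size U = sumFin n (χ ∘ U)

  size-< : ∀ V U x → V ⊆ U → U x ≡ true → V x ≡ false → size V < size U
  size-< V U x s ux vx = sumFin-mono-< n x pointwise (subst (λ q → χ (V x) < χ q) (sym ux) (subst (λ q → χ q < 1) (sym vx) (s≤s z≤n)))
    where
    pointwise : ∀ z → χ (V z) ≤ χ (U z)
    pointwise z with V z in eq
    ... | true rewrite s z eq = ≤-refl
    ... | false = z≤n

  vertexWeight : VSet n → ℕ
  vertexWeight U = prodFin n (λ z → if U z then 3 else 2)

  vertexWeight-cong : ∀ {U V} → (∀ z → U z ≡ V z) → vertexWeight U ≡ vertexWeight V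
  vertexWeight-cong e = prodFin-cong n (λ z → cong (λ q → if q then 3 else 2) (e z))

  vertexWeight-del : ∀ U x → U x ≡ true → vertexWeight (del x U) * 3 ≡ vertexWeight U * 2
  vertexWeight-del U x ux = begin
    vertexWeight (del x U) * 3                        ≡⟨ cong (λ q → vertexWeight (del x U) * (if q then 3 else 2)) (sym ux) ⟩
    vertexWeight (del x U) * (if U x then 3 else 2)   ≡⟨ prodFin-update n _ _ x (λ z ne → cong (λ q → if q then 3 else 2) (del-other ne)) ⟩
    vertexWeight U * (if del x U x then 3 else 2)     ≡⟨ cong (λ q → vertexWeight U * (if q then 3 else 2)) (del-self x U) ⟩
    vertexWeight U * 2                                ∎
    where open ≡-Reasoning

  vertexWeight-const : ∀ U b → (∀ z → U z ≡ b) → vertexWeight U ≡ (if b then 3 else 2) ^ n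
  vertexWeight-const U b h = trans (prodFin-cong n (λ z → cong (λ q → if q then 3 else 2) (h z))) (prodFin-const n _)

  module Matching (f : ℕ) (a b : Fin f → Fin n) (adjab : ∀ i → A (a i) (b i) ≡ true) where

    full : VSet n → Fin f → Bool
    full U i = U (a i) ∧ U (b i)

    covers : Fin f → Fin n → Bool
    covers i x = eqb x (a i) ∨ eqb x (b i)

    hits : VSet n → Fin n → Fin f → Bool
    hits U x i = full U i ∧ covers i x

    #hits : VSet n → Fin n → ℕ
    #hits U x = sumFin f (λ i → χ (hits U x i))

    Disjoint : VSet n → Set
    Disjoint U = ∀ x i j → hits U x i ≡ true → hits U x j ≡ true → i ≡ j

    Exposed : VSet n → Fin n → Set
    Exposed U x = ∀ i → hits U x i ≡ false

    pairWeight : VSet n → ℕ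
    pairWeight U = prodFin f (λ i → if full U i then 8 else 9)

    Φ : VSet n → ℕ
    Φ U = vertexWeight U * pairWeight U

    #exposed : VSet n → ℕ
    #exposed U = sumFin n (λ z → χ (U z ∧ not (anyFin f (hits U z))))

    #exposed≤n : ∀ U → #exposed U ≤ n
    #exposed≤n U = subst (#exposed U ≤_) (trans (sumFin-const n 1) (*-identityʳ n)) (sumFin-mono n (λ z → χ≤1 _))

    full-del : ∀ x U i → full (del x U) i ≡ full U i ∧ not (covers i x)
    full-del x U i rewrite del-def x U (a i) | del-def x U (b i) | eqb-sym (a i) x | eqb-sym (b i) x
      = rearrange (U (a i)) (U (b i)) (eqb x (a i)) (eqb x (b i))
      where
      rearrange : ∀ ua ub p q → (ua ∧ not p) ∧ (ub ∧ not q) ≡ (ua ∧ ub) ∧ not (p ∨ q)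
      rearrange true  true  true  q     = refl
      rearrange true  true  false true  = refl
      rearrange true  true  false false = refl
      rearrange true  false p     q     = ∧-zeroʳ (not p)
      rearrange false ub    p     q     = refl

    full-mono : ∀ {V U} → V ⊆ U → ∀ i → full V i ≡ true → full U i ≡ true
    full-mono {V} s i e = ∧-true (s (a i) (∧-true-l {V (a i)} e)) (s (b i) (∧-true-r {V (a i)} e))

    hits-mono : ∀ {V U} → V ⊆ U → ∀ x i → hits V x i ≡ true → hits U x i ≡ true
    hits-mono s x i e = ∧-true (full-mono s i (∧-true-l e)) (∧-true-r e)

    Disjoint-mono : ∀ {V U} → V ⊆ U → Disjoint U → Disjoint V
    Disjoint-mono s d x i j e₁ e₂ = d x i j (hits-mono s x i e₁) (hits-mono s x j e₂)

    Exposed-mono : ∀ {V U} → V ⊆ U → ∀ x → Exposed U x → Exposed V x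
    Exposed-mono {V} s x exp i =
      ≢true⇒≡false (λ e → true≢false (trans (sym (hits-mono s x i e)) (exp i)))

    pairWeight-del : ∀ x U → pairWeight (del x U) * 8 ^ #hits U x ≡ pairWeight U * 9 ^ #hits U x
    pairWeight-del x U = prodFin-if-update f (full U) (full (del x U)) (λ i → covers i x) 8 9 (full-del x U)

    pairWeight-cong : ∀ {U V} → (∀ z → U z ≡ V z) → pairWeight U ≡ pairWeight V
    pairWeight-cong e = prodFin-cong f (λ i → cong (λ q → if q then 8 else 9) (cong₂ _∧_ (e (a i)) (e (b i))))

    Φ-cong : ∀ {U V} → (∀ z → U z ≡ V z) → Φ U ≡ Φ V
    Φ-cong e = cong₂ _*_ (vertexWeight-cong e) (pairWeight-cong e)

    Φ-del : ∀ x U → U x ≡ true → Φ (del x U) * (3 * 8 ^ #hits U x) ≡ Φ U * (2 * 9 ^ #hits U x)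
    Φ-del x U ux = begin
      vertexWeight (del x U) * pairWeight (del x U) * (3 * 8 ^ c)  ≡⟨ interchange (vertexWeight (del x U)) (pairWeight (del x U)) 3 (8 ^ c) ⟩
      vertexWeight (del x U) * 3 * (pairWeight (del x U) * 8 ^ c)  ≡⟨ cong₂ _*_ (vertexWeight-del U x ux) (pairWeight-del x U) ⟩
      vertexWeight U * 2 * (pairWeight U * 9 ^ c)                  ≡⟨ interchange (vertexWeight U) (pairWeight U) 2 (9 ^ c) ⟨
      vertexWeight U * pairWeight U * (2 * 9 ^ c)                  ∎
      where
      open ≡-Reasoning
      c = #hits U x
      interchange : ∀ p q s t → p * q * (s * t) ≡ p * s * (q * t)
      interchange = solve-∀

    Φ-del-exposed : ∀ x U → U x ≡ true → Exposed U x → 3 * Φ (del x U) ≡ 2 * Φ U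
    Φ-del-exposed x U ux exp = begin
      3 * Φ (del x U)  ≡⟨ *-comm 3 (Φ (del x U)) ⟩
      Φ (del x U) * 3  ≡⟨ subst (λ c → Φ (del x U) * (3 * 8 ^ c) ≡ Φ U * (2 * 9 ^ c))
                                (sumFin-zero f (cong χ ∘ exp)) (Φ-del x U ux) ⟩
      Φ U * 2          ≡⟨ *-comm (Φ U) 2 ⟩
      2 * Φ U          ∎
      where open ≡-Reasoning

    -- In a disjoint U, x hits at most one full pair: the factor is 2/3 or (2/3)(9/8) = 3/4.
    Φ-del-ratio : ∀ x U → U x ≡ true → Disjoint U → 4 * Φ (del x U) ≤ 3 * Φ U
    Φ-del-ratio x U ux d with ≤1-cases (#hits U x) (sumFin-χ-≤1 f (hits U x) (d x)) | Φ-del x U ux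
    ... | inj₁ e | h rewrite e = ratio-from-eq (Φ (del x U)) (Φ U) 3 2 4 3 h (≤ᵇ⇒≤ 8 9 _)
    ... | inj₂ e | h rewrite e = ratio-from-eq (Φ (del x U)) (Φ U) 24 18 4 3 h ≤-refl

    Φ-del-≤ : ∀ x U → Disjoint U → Φ (del x U) ≤ Φ U
    Φ-del-≤ x U d with U x in eq
    ... | true  = *-cancelˡ-≤ 3 (≤-trans (*-monoˡ-≤ (Φ (del x U)) (m≤m+n 3 1)) (Φ-del-ratio x U eq d))
    ... | false = ≤-reflexive (Φ-cong (del-absent x U eq))

    Φ-mono : ∀ V U → V ⊆ U → Disjoint U → Φ V ≤ Φ U
    Φ-mono V U s d = ⊆-mono-by-del Φ Φ-cong U (λ x W W⊆U → Φ-del-≤ x W (Disjoint-mono W⊆U d)) V s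

    Exposed-del-partner : ∀ U x y i → Disjoint U → hits U x i ≡ true → covers i y ≡ true → Exposed (del y U) x
    Exposed-del-partner U x y i d hx cy j = ≢true⇒≡false λ e → gone e (d x j i (hits-mono (del-⊆ y U) x j e) hx)
      where
      gone : hits (del y U) x j ≡ true → j ≡ i → ⊥
      gone e refl = true≢false (trans (sym (∧-true-l e))
                      (trans (full-del y U j) (trans (cong (λ q → full U j ∧ not q) cy) (∧-zeroʳ (full U j)))))

    partnerIn : Fin f → Fin n → Fin n
    partnerIn i x = if eqb x (a i) then b i else a i

    covers-cases : ∀ i x → covers i x ≡ true → x ≡ a i ⊎ x ≡ b i
    covers-cases i x e with eqb x (a i) in e₁
    ... | true  = inj₁ (eqb-true⁻ e₁)
    ... | false = inj₂ (eqb-true⁻ e)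

    partnerIn-a : ∀ i → partnerIn i (a i) ≡ b i
    partnerIn-a i rewrite eqb-refl (a i) = refl

    partnerIn-b : ∀ i → partnerIn i (b i) ≡ a i
    partnerIn-b i rewrite eqb-false (A-≢′ (adjab i)) = refl

    covers-partnerIn : ∀ i x → covers i (partnerIn i x) ≡ true
    covers-partnerIn i x with eqb x (a i)
    ... | true  rewrite eqb-refl (b i) = ∨-zeroʳ (eqb (b i) (a i))
    ... | false rewrite eqb-refl (a i) = refl

    partnerIn-≢ : ∀ i x → covers i x ≡ true → partnerIn i x ≢ x
    partnerIn-≢ i x m with covers-cases i x m
    ... | inj₁ refl rewrite partnerIn-a i = A-≢′ (adjab i)
    ... | inj₂ refl rewrite partnerIn-b i = A-≢ (adjab i)

    partnerIn-adj : ∀ i x → covers i x ≡ true → A x (partnerIn i x) ≡ true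
    partnerIn-adj i x m with covers-cases i x m
    ... | inj₁ refl rewrite partnerIn-a i = adjab i
    ... | inj₂ refl rewrite partnerIn-b i = A-sym-true (adjab i)

    partnerIn-∈ : ∀ U i x → full U i ≡ true → U (partnerIn i x) ≡ true
    partnerIn-∈ U i x fu with eqb x (a i)
    ... | true  = ∧-true-r fu
    ... | false = ∧-true-l fu

    covers-partnerIn-cases : ∀ i x z → covers i x ≡ true → covers i z ≡ true → z ≡ x ⊎ z ≡ partnerIn i x
    covers-partnerIn-cases i x z cx cz with covers-cases i x cx | covers-cases i z cz
    ... | inj₁ refl | inj₁ refl = inj₁ refl
    ... | inj₂ refl | inj₂ refl = inj₁ refl
    ... | inj₁ refl | inj₂ refl rewrite partnerIn-a i = inj₂ refl
    ... | inj₂ refl | inj₁ refl rewrite partnerIn-b i = inj₂ refl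


  -- The bounds of the two branches at a vertex add up, and a leaf is bounded by the induction
  -- hypothesis for a proper subset V ⊆ W ⊆ U together with Ψ W ≤ (N / D) · Ψ U.
  module Branching (U : VSet n) (Ψ : VSet n → ℕ) (K : ℕ)
      (IH : ∀ V → V ⊆ U → ∀ x → U x ≡ true → V x ≡ false → misIn V * K ≤ Ψ V)
      (Ψ-mono : ∀ V W → V ⊆ W → W ⊆ U → Ψ V ≤ Ψ W) where
    open Ratios Ψ public

    record Bound (N D c : ℕ) : Set where
      constructor mkB
      field unB : D * (c * K) ≤ N * Ψ U

    bound-leaf : ∀ {N D} c V W x → c ≤ misIn V → V ⊆ W → W ⊆ U → U x ≡ true → V x ≡ false →
                 Ratio≤ N D W U → Bound N D c
    bound-leaf {N} {D} c V W x le s₁ s₂ ux vx (mkR r) = mkB (begin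
      D * (c * K)        ≤⟨ *-monoʳ-≤ D (*-monoˡ-≤ K le) ⟩
      D * (misIn V * K)  ≤⟨ *-monoʳ-≤ D (IH V (⊆-trans s₁ s₂) x ux vx) ⟩
      D * Ψ V            ≤⟨ *-monoʳ-≤ D (Ψ-mono V W s₁ s₂) ⟩
      D * Ψ W            ≤⟨ r ⟩
      N * Ψ U            ∎)
      where open ≤-Reasoning

    -- The leaf of the branch w ∈ S is G[U − N[w] − Out], which lies inside U − xs.
    bound-in : ∀ {N D} w Out xs → U w ≡ true → All (λ o → o ≡ w ⊎ o ∈ Out ⊎ A w o ≡ true) xs →
               Ratio≤ N D (delAll xs U) U → Bound N D (misWith U (w ∷ []) Out)
    bound-in w Out xs uw hs r =
      bound-leaf _ (delAll Out (delNbhd w U)) (delAll xs U) w (misWith-in≤ U w Out) sub (delAll-⊆ xs) uw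
        (≢true-at (delAll Out (delNbhd w U)) w (λ e → delNbhd-≢ (delAll-sub Out e) refl)) r
      where
      sub : delAll Out (delNbhd w U) ⊆ delAll xs U
      sub z e = delAll-intro xs (delNbhd-sub e′) λ m → removed (All.lookup hs m)
        where
        e′ = delAll-sub Out e
        removed : ∀ {o} → (o ≡ w ⊎ o ∈ Out ⊎ A w o ≡ true) → z ≢ o
        removed (inj₁ refl)        eq   = delNbhd-≢ e′ eq
        removed (inj₂ (inj₁ m))    eq   = delAll-∉ Out e m eq
        removed (inj₂ (inj₂ adjw)) refl = true≢false (trans (sym adjw) (delNbhd-nonadj e′))

    bound-out : ∀ {N D} Out xs o → o ∈ Out → U o ≡ true → All (_∈ Out) xs →
                Ratio≤ N D (delAll xs U) U → Bound N D (misWith U [] Out)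
    bound-out Out xs o mo uo hs r =
      bound-leaf _ (delAll Out U) (delAll xs U) o (misWith-out≤ U Out) sub (delAll-⊆ xs) uo
        (≢true-at (delAll Out U) o (λ e → delAll-∉ Out e mo refl)) r
      where
      sub : delAll Out U ⊆ delAll xs U
      sub z e = delAll-intro xs (delAll-sub Out e) λ m → delAll-∉ Out e (All.lookup hs m)

    bound-zero : ∀ {D} In Out v → U v ≡ true → v ∈ Out → (∀ y → U y ≡ true → A v y ≡ true → y ∈ Out) →
                 Bound 0 D (misWith U In Out)
    bound-zero {D} In Out v uv vo nb rewrite misWith-undominated U In Out v uv vo nb =
      mkB (≤-reflexive (*-zeroʳ D))

    bound-split : ∀ {N₁ N₂ D} In Out x → Bound N₁ D (misWith U (x ∷ In) Out) → Bound N₂ D (misWith U In (x ∷ Out)) →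
                  Bound (N₁ + N₂) D (misWith U In Out)
    bound-split {N₁} {N₂} {D} In Out x (mkB b₁) (mkB b₂) rewrite misWith-split U In Out x = mkB (begin
      D * ((c₁ + c₂) * K)        ≡⟨ distrib D c₁ c₂ K ⟩
      D * (c₁ * K) + D * (c₂ * K) ≤⟨ +-mono-≤ b₁ b₂ ⟩
      N₁ * Ψ U + N₂ * Ψ U        ≡⟨ *-distribʳ-+ (Ψ U) N₁ N₂ ⟨
      (N₁ + N₂) * Ψ U            ∎)
      where
      open ≤-Reasoning
      c₁ = misWith U (x ∷ In) Out
      c₂ = misWith U In (x ∷ Out)
      distrib : ∀ d p q k → d * ((p + q) * k) ≡ d * (p * k) + d * (q * k)
      distrib = solve-∀

    bound-weaken : ∀ {N N′ D c} → Bound N D c → {_ : T (N ≤ᵇ N′)} → Bound N′ D c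
    bound-weaken {N} {N′} (mkB b) {p} = mkB (≤-trans b (*-monoˡ-≤ (Ψ U) (≤ᵇ⇒≤ N N′ p)))

    bound-total : ∀ {N D} .{{_ : NonZero D}} → Bound N D (misIn U) → {_ : T (N ≤ᵇ D)} → misIn U * K ≤ Ψ U
    bound-total {N} {D} (mkB b) {p} = *-cancelˡ-≤ D (≤-trans b (*-monoˡ-≤ (Ψ U) (≤ᵇ⇒≤ N D p)))


  NewNbr : VSet n → Fin n → List (Fin n) → Fin n → Set
  NewNbr U x L y = U y ≡ true × A x y ≡ true × All (y ≢_) L

  HasNbrs : VSet n → ℕ → Fin n → List (Fin n) → Set
  HasNbrs U zero x L = ⊤
  HasNbrs U (suc k) x L = Σ (Fin n) λ y → NewNbr U x L y × HasNbrs U k x (y ∷ L)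

  NewNbr? : ∀ U x L y → Dec (NewNbr U x L y)
  NewNbr? U x L y = (U y ≟B true) ×-dec ((A x y ≟B true) ×-dec All.all? (λ o → ¬? (y ≟F o)) L)

  HasNbrs? : ∀ U k x L → Dec (HasNbrs U k x L)
  HasNbrs? U zero x L = yes tt
  HasNbrs? U (suc k) x L = any? (λ y → NewNbr? U x L y ×-dec HasNbrs? U k x (y ∷ L))

  nbrs-listed : ∀ U x L → ¬ (Σ (Fin n) λ y → NewNbr U x L y) → ∀ y → U y ≡ true → A x y ≡ true → y ∈ L
  nbrs-listed U x L h y uy axy with Any.any? (y ≟F_) L
  ... | yes m = m
  ... | no ¬m = ⊥-elim (h (y , uy , axy , ¬Any⇒All¬ L ¬m))

  module MatchingCases (f : ℕ) (a b : Fin f → Fin n) (adjab : ∀ i → A (a i) (b i) ≡ true) (U : VSet n)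
     (d : Matching.Disjoint f a b adjab U)
     (IH : ∀ V → V ⊆ U → ∀ x → U x ≡ true → V x ≡ false → misIn V * (2 ^ n * 9 ^ f) ≤ Matching.Φ f a b adjab V) where
    open Matching f a b adjab

    K : ℕ
    K = 2 ^ n * 9 ^ f

    open Branching U Φ K IH (λ V W V⊆W W⊆U → Φ-mono V W V⊆W (Disjoint-mono W⊆U d)) public

    step : ∀ x xs → U x ≡ true → All (x ≢_) xs → Ratio≤ 3 4 (delAll (x ∷ xs) U) (delAll xs U)
    step x xs ux ne = mkR (Φ-del-ratio x (delAll xs U) (delAll-intro xs ux (All.lookup ne)) (Disjoint-mono (delAll-⊆ xs) d))

    step-exposed : ∀ x xs → U x ≡ true → All (x ≢_) xs → Exposed (delAll xs U) x →
                   Ratio≤ 2 3 (delAll (x ∷ xs) U) (delAll xs U)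
    step-exposed x xs ux ne exp = mkR (≤-reflexive (Φ-del-exposed x (delAll xs U) (delAll-intro xs ux (All.lookup ne)) exp))

    Exposed-delAll : ∀ x xs → Exposed U x → Exposed (delAll xs U) x
    Exposed-delAll x xs = Exposed-mono (delAll-⊆ xs) x

    record Matched (y : Fin n) : Set where
      constructor matched
      field
        pair      : Fin f
        pair-hits : hits U y pair ≡ true

    partner : ∀ {y} → Matched y → Fin n
    partner {y} (matched i h) = partnerIn i y

    partner-∈ : ∀ {y} (m : Matched y) → U (partner m) ≡ true
    partner-∈ {y} (matched i h) = partnerIn-∈ U i y (∧-true-l h)

    partner-≢ : ∀ {y} (m : Matched y) → partner m ≢ y
    partner-≢ {y} (matched i h) = partnerIn-≢ i y (∧-true-r {full U i} h)

    partner-adj : ∀ {y} (m : Matched y) → A y (partner m) ≡ true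
    partner-adj {y} (matched i h) = partnerIn-adj i y (∧-true-r {full U i} h)

    partner-hits : ∀ {y} (m : Matched y) → hits U (partner m) (Matched.pair m) ≡ true
    partner-hits {y} (matched i h) = ∧-true (∧-true-l h) (covers-partnerIn i y)

    partner-exposed : ∀ {y} (m : Matched y) xs → y ∈ xs → Exposed (delAll xs U) (partner m)
    partner-exposed {y} m@(matched i h) xs mem = Exposed-mono (delAll-⊆-del y xs mem) (partner m)
      (Exposed-del-partner U (partner m) y i d (partner-hits m) (∧-true-r {full U i} h))

    exposed-without-partner : ∀ {y} (m : Matched y) xs → partner m ∈ xs → Exposed (delAll xs U) y
    exposed-without-partner {y} (matched i h) xs mem = Exposed-mono (delAll-⊆-del (partnerIn i y) xs mem) y
      (Exposed-del-partner U y (partnerIn i y) i d h (covers-partnerIn i y))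

    exposed-≢-partner : ∀ {x y} → Exposed U x → (m : Matched y) → x ≢ partner m
    exposed-≢-partner exp m refl = true≢false (trans (sym (partner-hits m)) (exp (Matched.pair m)))

    -- The pairs are disjoint, so two vertices sharing a pair are equal or partners.
    partner-≢-other : ∀ {y z} (my : Matched y) (mz : Matched z) → z ≢ y → z ≢ partner my → partner mz ≢ y
    partner-≢-other {y} {z} my@(matched i hi) mz@(matched j hj) ne₁ ne₂ eq
      with d y i j hi (subst (λ q → hits U q j ≡ true) eq (partner-hits mz))
    ... | refl with covers-partnerIn-cases i y z (∧-true-r {full U i} hi) (∧-true-r {full U i} hj)
    ...   | inj₁ e = ne₁ e
    ...   | inj₂ e = ne₂ e

    partner-≢-partner : ∀ {y z} (my : Matched y) (mz : Matched z) → z ≢ y → z ≢ partner my → partner mz ≢ partner my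
    partner-≢-partner {y} {z} my@(matched i hi) mz@(matched j hj) ne₁ ne₂ eq
      with d (partnerIn i y) j i (subst (λ q → hits U q j ≡ true) eq (partner-hits mz)) (partner-hits my)
    ... | refl with covers-partnerIn-cases i y z (∧-true-r {full U i} hi) (∧-true-r {full U i} hj)
    ...   | inj₁ e = ne₁ e
    ...   | inj₂ e = ne₂ e

    partner-sym : ∀ {y z} (my : Matched y) (mz : Matched z) → z ≡ partner my → partner mz ≡ y
    partner-sym {y} my@(matched i hi) mz@(matched j hj) refl with d (partnerIn i y) i j (partner-hits my) hj
    ... | refl with covers-partnerIn-cases i (partnerIn i y) y (covers-partnerIn i y) (∧-true-r {full U i} hi)
    ...   | inj₁ e = ⊥-elim (partnerIn-≢ i y (∧-true-r {full U i} hi) (sym e))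
    ...   | inj₂ e = sym e

    exposed-isolated : ∀ x → U x ≡ true → Exposed U x → (∀ y → U y ≡ true → A x y ≡ true → ⊥) → misIn U * K ≤ Φ U
    exposed-isolated x ux ex nb = bound-total {2} {3}
      (bound-split [] [] x
        (bound-in x [] (x ∷ []) ux (inj₁ refl ∷ []) (step-exposed x [] ux [] ex))
        (bound-zero [] (x ∷ []) x ux (here refl) (λ y uy axy → ⊥-elim (nb y uy axy))))

    exposed-one-nbr : ∀ x y1 → U x ≡ true → Exposed U x → U y1 ≡ true → A x y1 ≡ true → Matched y1 →
               (∀ y → U y ≡ true → A x y ≡ true → y ≡ y1) → misIn U * K ≤ Φ U
    exposed-one-nbr x y1 ux ex uy1 axy my1 nb = bound-total {5} {6}
      (bound-split [] [] x
        (bound-in x [] (y1 ∷ x ∷ []) ux (inj₂ (inj₂ axy) ∷ inj₁ refl ∷ [])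
           (relax 3 6 (step y1 (x ∷ []) uy1 (A-≢′ axy ∷ []) ⨾ step-exposed x [] ux [] ex)))
        (bound-split [] (x ∷ []) y1
          (bound-in y1 (x ∷ []) (x ∷ y1′ ∷ y1 ∷ []) uy1 (inj₂ (inj₁ (here refl)) ∷ inj₂ (inj₂ (partner-adj my1)) ∷ inj₁ refl ∷ [])
            (relax 2 6 (step-exposed x (y1′ ∷ y1 ∷ []) ux (exposed-≢-partner ex my1 ∷ A-≢ axy ∷ []) (Exposed-delAll x (y1′ ∷ y1 ∷ []) ex) ⨾
                        step-exposed y1′ (y1 ∷ []) (partner-∈ my1) (partner-≢ my1 ∷ []) (partner-exposed my1 (y1 ∷ []) (here refl)) ⨾
                        step y1 [] uy1 [])))
          (bound-zero [] (y1 ∷ x ∷ []) x ux (there (here refl)) (λ y uy axy′ → here (nb y uy axy′)))))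
      where y1′ = partner my1

    exposed-three-nbrs : ∀ x y1 y2 y3 → U x ≡ true → Exposed U x →
               U y1 ≡ true → A x y1 ≡ true → U y2 ≡ true → A x y2 ≡ true → U y3 ≡ true → A x y3 ≡ true →
               y2 ≢ y1 → y3 ≢ y2 → y3 ≢ y1 → misIn U * K ≤ Φ U
    exposed-three-nbrs x y1 y2 y3 ux ex u1 a1 u2 a2 u3 a3 n21 n32 n31 = bound-total {91} {96}
      (bound-split [] [] x
        (bound-in x [] (y3 ∷ y2 ∷ y1 ∷ x ∷ []) ux (inj₂ (inj₂ a3) ∷ inj₂ (inj₂ a2) ∷ inj₂ (inj₂ a1) ∷ inj₁ refl ∷ [])
          (relax 27 96 (step y3 (y2 ∷ y1 ∷ x ∷ []) u3 (n32 ∷ n31 ∷ A-≢′ a3 ∷ []) ⨾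
                        step y2 (y1 ∷ x ∷ []) u2 (n21 ∷ A-≢′ a2 ∷ []) ⨾
                        step y1 (x ∷ []) u1 (A-≢′ a1 ∷ []) ⨾
                        step-exposed x [] ux [] ex)))
        (bound-out (x ∷ []) (x ∷ []) x (here refl) ux (here refl ∷ [])
          (relax 64 96 (step-exposed x [] ux [] ex))))

    exposed-two-nbrs : ∀ x y1 y2 → U x ≡ true → Exposed U x →
               U y1 ≡ true → A x y1 ≡ true → U y2 ≡ true → A x y2 ≡ true → y2 ≢ y1 →
               Matched y1 → Matched y2 →
               (∀ y → U y ≡ true → A x y ≡ true → y ∈ (y2 ∷ y1 ∷ [])) → misIn U * K ≤ Φ U
    exposed-two-nbrs x y1 y2 ux ex u1 a1 u2 a2 n21 m1 m2 nb with y2 ≟F partner m1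
    ... | yes e = bound-total {3} {3}
      (bound-split [] [] x
        (bound-in x [] (y2 ∷ y1 ∷ x ∷ []) ux (inj₂ (inj₂ a2) ∷ inj₂ (inj₂ a1) ∷ inj₁ refl ∷ [])
          (relax 1 3 (step-exposed y2 (y1 ∷ x ∷ []) u2 (n21 ∷ A-≢′ a2 ∷ [])
                      (subst (λ q → Exposed (delAll (y1 ∷ x ∷ []) U) q) (sym e) (partner-exposed m1 (y1 ∷ x ∷ []) (here refl))) ⨾
                  step y1 (x ∷ []) u1 (A-≢′ a1 ∷ []) ⨾
                           step-exposed x [] ux [] ex)))
        (bound-out (x ∷ []) (x ∷ []) x (here refl) ux (here refl ∷ [])
          (relax 2 3 (step-exposed x [] ux [] ex))))
    ... | no ne = bound-total {23} {24}
      (bound-split [] [] x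
        (bound-in x [] (y2 ∷ y1 ∷ x ∷ []) ux (inj₂ (inj₂ a2) ∷ inj₂ (inj₂ a1) ∷ inj₁ refl ∷ [])
          (relax 9 24 (step y2 (y1 ∷ x ∷ []) u2 (n21 ∷ A-≢′ a2 ∷ []) ⨾
                       step y1 (x ∷ []) u1 (A-≢′ a1 ∷ []) ⨾
                       step-exposed x [] ux [] ex)))
        (bound-split [] (x ∷ []) y1
          (bound-in y1 (x ∷ []) (x ∷ y1′ ∷ y1 ∷ []) u1 (inj₂ (inj₁ (here refl)) ∷ inj₂ (inj₂ (partner-adj m1)) ∷ inj₁ refl ∷ [])
            (relax 8 24 (step-exposed x (y1′ ∷ y1 ∷ []) ux (exposed-≢-partner ex m1 ∷ A-≢ a1 ∷ []) (Exposed-delAll x (y1′ ∷ y1 ∷ []) ex) ⨾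
                         step-exposed y1′ (y1 ∷ []) (partner-∈ m1) (partner-≢ m1 ∷ []) (partner-exposed m1 (y1 ∷ []) (here refl)) ⨾
                         step y1 [] u1 [])))
          (bound-split [] (y1 ∷ x ∷ []) y2
            (bound-in y2 (y1 ∷ x ∷ []) (y1 ∷ x ∷ y2′ ∷ y2 ∷ []) u2
               (inj₂ (inj₁ (here refl)) ∷ inj₂ (inj₁ (there (here refl))) ∷ inj₂ (inj₂ (partner-adj m2)) ∷ inj₁ refl ∷ [])
               (relax 6 24 (step y1 (x ∷ y2′ ∷ y2 ∷ []) u1 (A-≢′ a1 ∷ (λ e → partner-≢-other m1 m2 n21 ne (sym e)) ∷ (≢-sym n21) ∷ []) ⨾
                            step-exposed x (y2′ ∷ y2 ∷ []) ux (exposed-≢-partner ex m2 ∷ A-≢ a2 ∷ []) (Exposed-delAll x (y2′ ∷ y2 ∷ []) ex) ⨾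
                            step-exposed y2′ (y2 ∷ []) (partner-∈ m2) (partner-≢ m2 ∷ []) (partner-exposed m2 (y2 ∷ []) (here refl)) ⨾
                            step y2 [] u2 [])))
            (bound-zero [] (y2 ∷ y1 ∷ x ∷ []) x ux (there (there (here refl)))
               (λ y uy axy → sub (nb y uy axy))))))
      where
      y1′ = partner m1
      y2′ = partner m2
      sub : ∀ {y} → y ∈ (y2 ∷ y1 ∷ []) → y ∈ (y2 ∷ y1 ∷ x ∷ [])
      sub (here e) = here e
      sub (there (here e)) = there (here e)

    matched-four-nbrs : ∀ x w1 w2 w3 → U x ≡ true → (mx : Matched x) →
               U w1 ≡ true → A x w1 ≡ true → U w2 ≡ true → A x w2 ≡ true → U w3 ≡ true → A x w3 ≡ true →
               w2 ≢ w1 → w3 ≢ w2 → w3 ≢ w1 → w1 ≢ partner mx → w2 ≢ partner mx → w3 ≢ partner mx → misIn U * K ≤ Φ U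
    matched-four-nbrs x w1 w2 w3 ux mx u1 a1 u2 a2 u3 a3 n21 n32 n31 p1 p2 p3 = bound-total {123} {128}
      (bound-split [] [] x
        (bound-in x [] (w3 ∷ w2 ∷ w1 ∷ x′ ∷ x ∷ []) ux (inj₂ (inj₂ a3) ∷ inj₂ (inj₂ a2) ∷ inj₂ (inj₂ a1) ∷ inj₂ (inj₂ (partner-adj mx)) ∷ inj₁ refl ∷ [])
          (relax 27 128 (step w3 (w2 ∷ w1 ∷ x′ ∷ x ∷ []) u3 (n32 ∷ n31 ∷ p3 ∷ A-≢′ a3 ∷ []) ⨾
                         step w2 (w1 ∷ x′ ∷ x ∷ []) u2 (n21 ∷ p2 ∷ A-≢′ a2 ∷ []) ⨾
                         step w1 (x′ ∷ x ∷ []) u1 (p1 ∷ A-≢′ a1 ∷ []) ⨾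
                         step-exposed x′ (x ∷ []) (partner-∈ mx) (partner-≢ mx ∷ []) (partner-exposed mx (x ∷ []) (here refl)) ⨾
                         step x [] ux [])))
        (bound-out (x ∷ []) (x ∷ []) x (here refl) ux (here refl ∷ [])
          (relax 96 128 (step x [] ux []))))
      where x′ = partner mx

    matched-one-nbr : ∀ x → U x ≡ true → (mx : Matched x) → (∀ y → U y ≡ true → A x y ≡ true → y ≡ partner mx) → misIn U * K ≤ Φ U
    matched-one-nbr x ux mx nb = bound-total {2} {2}
      (bound-split [] [] x
        (bound-in x [] (x′ ∷ x ∷ []) ux (inj₂ (inj₂ (partner-adj mx)) ∷ inj₁ refl ∷ [])
          (relax 1 2 (step-exposed x′ (x ∷ []) (partner-∈ mx) (partner-≢ mx ∷ []) (partner-exposed mx (x ∷ []) (here refl)) ⨾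
                      step x [] ux [])))
        (bound-split [] (x ∷ []) x′
          (bound-in x′ (x ∷ []) (x ∷ x′ ∷ []) (partner-∈ mx) (inj₂ (inj₁ (here refl)) ∷ inj₁ refl ∷ [])
            (relax 1 2 (step-exposed x (x′ ∷ []) ux ((λ e → partner-≢ mx (sym e)) ∷ []) (exposed-without-partner mx (x′ ∷ []) (here refl)) ⨾
                        step x′ [] (partner-∈ mx) [])))
          (bound-zero [] (x′ ∷ x ∷ []) x ux (there (here refl)) (λ y uy axy → here (nb y uy axy)))))
      where x′ = partner mx

    matched-two-nbrs : ∀ x c e → U x ≡ true → (mx : Matched x) → U c ≡ true → A x c ≡ true → c ≢ partner mx → (mc : Matched c) →
                U e ≡ true → A (partner mx) e ≡ true → e ≢ x →
                (∀ y → U y ≡ true → A x y ≡ true → y ∈ (c ∷ partner mx ∷ [])) → misIn U * K ≤ Φ U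
    matched-two-nbrs x c e ux mx uc ac cx′ mc ue ae ex nb = bound-total {8} {8}
      (bound-split [] [] x
        (bound-in x [] (c ∷ x′ ∷ x ∷ []) ux (inj₂ (inj₂ ac) ∷ inj₂ (inj₂ (partner-adj mx)) ∷ inj₁ refl ∷ [])
          (relax 3 8 (step c (x′ ∷ x ∷ []) uc (cx′ ∷ A-≢′ ac ∷ []) ⨾
                      step-exposed x′ (x ∷ []) (partner-∈ mx) (partner-≢ mx ∷ []) (partner-exposed mx (x ∷ []) (here refl)) ⨾
                      step x [] ux [])))
        (bound-split [] (x ∷ []) x′
          (bound-in x′ (x ∷ []) (e ∷ x ∷ x′ ∷ []) (partner-∈ mx) (inj₂ (inj₂ ae) ∷ inj₂ (inj₁ (here refl)) ∷ inj₁ refl ∷ [])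
            (relax 3 8 (step e (x ∷ x′ ∷ []) ue (ex ∷ A-≢′ ae ∷ []) ⨾
                        step-exposed x (x′ ∷ []) ux ((λ q → partner-≢ mx (sym q)) ∷ []) (exposed-without-partner mx (x′ ∷ []) (here refl)) ⨾
                        step x′ [] (partner-∈ mx) [])))
          (bound-split [] (x′ ∷ x ∷ []) c
            (bound-in c (x′ ∷ x ∷ []) (x′ ∷ x ∷ c′ ∷ c ∷ []) uc
               (inj₂ (inj₁ (here refl)) ∷ inj₂ (inj₁ (there (here refl))) ∷ inj₂ (inj₂ (partner-adj mc)) ∷ inj₁ refl ∷ [])
               (relax 2 8 (step-exposed x′ (x ∷ c′ ∷ c ∷ []) (partner-∈ mx) (partner-≢ mx ∷ x′c′ ∷ (≢-sym cx′) ∷ []) (partner-exposed mx (x ∷ c′ ∷ c ∷ []) (here refl)) ⨾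
                           step x (c′ ∷ c ∷ []) ux (xc′ ∷ A-≢ ac ∷ []) ⨾
                           step-exposed c′ (c ∷ []) (partner-∈ mc) (partner-≢ mc ∷ []) (partner-exposed mc (c ∷ []) (here refl)) ⨾
                           step c [] uc [])))
            (bound-zero [] (c ∷ x′ ∷ x ∷ []) x ux (there (there (here refl)))
               (λ y uy axy → sub (nb y uy axy))))))
      where
      x′ = partner mx
      c′ = partner mc
      xc′ : x ≢ c′
      xc′ q = partner-≢-other mx mc (A-≢′ ac) cx′ (sym q)
      x′c′ : x′ ≢ c′
      x′c′ q = partner-≢-partner mx mc (A-≢′ ac) cx′ (sym q)
      sub : ∀ {y} → y ∈ (c ∷ x′ ∷ []) → y ∈ (c ∷ x′ ∷ x ∷ [])
      sub (here e) = here e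
      sub (there (here e)) = there (here e)

    branch-partner-in : ∀ x (mx : Matched x) e1 e2 → U x ≡ true → U e1 ≡ true → A (partner mx) e1 ≡ true → U e2 ≡ true → A (partner mx) e2 ≡ true →
             e2 ≢ e1 → e1 ≢ x → e2 ≢ x → Bound 9 32 (misWith U (partner mx ∷ []) (x ∷ []))
    branch-partner-in x mx e1 e2 ux ue1 ae1 ue2 ae2 ne21 e1x e2x = bound-in x′ (x ∷ []) (e2 ∷ e1 ∷ x ∷ x′ ∷ []) (partner-∈ mx)
         (inj₂ (inj₂ ae2) ∷ inj₂ (inj₂ ae1) ∷ inj₂ (inj₁ (here refl)) ∷ inj₁ refl ∷ [])
         (relax 9 32 (step e2 (e1 ∷ x ∷ x′ ∷ []) ue2 (ne21 ∷ e2x ∷ A-≢′ ae2 ∷ []) ⨾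
                      step e1 (x ∷ x′ ∷ []) ue1 (e1x ∷ A-≢′ ae1 ∷ []) ⨾
                      step-exposed x (x′ ∷ []) ux ((λ q → partner-≢ mx (sym q)) ∷ []) (exposed-without-partner mx (x′ ∷ []) (here refl)) ⨾
                      step x′ [] (partner-∈ mx) []))
      where x′ = partner mx

    branch-nbr-in : ∀ x (mx : Matched x) → U x ≡ true → ∀ c (mc : Matched c) → U c ≡ true → A x c ≡ true → c ≢ partner mx → Bound 8 32 (misWith U (c ∷ []) (partner mx ∷ x ∷ []))
    branch-nbr-in x mx ux c mc uc ac cx′ = bound-in c (x′ ∷ x ∷ []) (x′ ∷ x ∷ partner mc ∷ c ∷ []) uc
               (inj₂ (inj₁ (here refl)) ∷ inj₂ (inj₁ (there (here refl))) ∷ inj₂ (inj₂ (partner-adj mc)) ∷ inj₁ refl ∷ [])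
               (relax 8 32 (step-exposed x′ (x ∷ partner mc ∷ c ∷ []) (partner-∈ mx) (partner-≢ mx ∷ (λ q → partner-≢-partner mx mc (A-≢′ ac) cx′ (sym q)) ∷ (≢-sym cx′) ∷ []) (partner-exposed mx (x ∷ partner mc ∷ c ∷ []) (here refl)) ⨾
                            step x (partner mc ∷ c ∷ []) ux ((λ q → partner-≢-other mx mc (A-≢′ ac) cx′ (sym q)) ∷ A-≢ ac ∷ []) ⨾
                            step-exposed (partner mc) (c ∷ []) (partner-∈ mc) (partner-≢ mc ∷ []) (partner-exposed mc (c ∷ []) (here refl)) ⨾
                            step c [] uc []))
      where x′ = partner mx

    module ThreeNbrs (x c1 c2 e1 e2 z1 z2 : Fin n) (ux : U x ≡ true) (mx : Matched x)
        (u1 : U c1 ≡ true) (a1 : A x c1 ≡ true) (u2 : U c2 ≡ true) (a2 : A x c2 ≡ true)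
        (n21 : c2 ≢ c1) (c1x′ : c1 ≢ partner mx) (c2x′ : c2 ≢ partner mx) (mc1 : Matched c1) (mc2 : Matched c2)
        (nb : ∀ y → U y ≡ true → A x y ≡ true → y ∈ (c2 ∷ c1 ∷ partner mx ∷ []))
        (ue1 : U e1 ≡ true) (ae1 : A (partner mx) e1 ≡ true) (ue2 : U e2 ≡ true) (ae2 : A (partner mx) e2 ≡ true)
        (ne21 : e2 ≢ e1) (e1x : e1 ≢ x) (e2x : e2 ≢ x)
        (uz1 : U z1 ≡ true) (az1 : A c1 z1 ≡ true) (z1c1′ : z1 ≢ partner mc1) (z1x : z1 ≢ x)
        (uz2 : U z2 ≡ true) (az2 : A c2 z2 ≡ true) (z2c2′ : z2 ≢ partner mc2) (z2x : z2 ≢ x) where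

      x′ = partner mx

      undominated : Bound 0 32 (misWith U [] (c2 ∷ c1 ∷ x′ ∷ x ∷ []))
      undominated = bound-zero [] (c2 ∷ c1 ∷ x′ ∷ x ∷ []) x ux (there (there (there (here refl)))) (λ y uy axy → sub (nb y uy axy))
        where
        sub : ∀ {y} → y ∈ (c2 ∷ c1 ∷ x′ ∷ []) → y ∈ (c2 ∷ c1 ∷ x′ ∷ x ∷ [])
        sub (here e)                 = here e
        sub (there (here e))         = there (here e)
        sub (there (there (here e))) = there (there (here e))

      unpaired : c2 ≢ partner mc1 → misIn U * K ≤ Φ U
      unpaired ¬P = bound-total {32} {32}
        (bound-split [] [] x
          (bound-in x [] (c2 ∷ c1 ∷ x′ ∷ x ∷ []) ux (inj₂ (inj₂ a2) ∷ inj₂ (inj₂ a1) ∷ inj₂ (inj₂ (partner-adj mx)) ∷ inj₁ refl ∷ [])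
            (relax 9 32 (step c2 (c1 ∷ x′ ∷ x ∷ []) u2 (n21 ∷ c2x′ ∷ A-≢′ a2 ∷ []) ⨾
                         step c1 (x′ ∷ x ∷ []) u1 (c1x′ ∷ A-≢′ a1 ∷ []) ⨾
                         step-exposed x′ (x ∷ []) (partner-∈ mx) (partner-≢ mx ∷ []) (partner-exposed mx (x ∷ []) (here refl)) ⨾
                         step x [] ux [])))
          (bound-split [] (x ∷ []) x′ (branch-partner-in x mx e1 e2 ux ue1 ae1 ue2 ae2 ne21 e1x e2x)
            (bound-split [] (x′ ∷ x ∷ []) c1 (branch-nbr-in x mx ux c1 mc1 u1 a1 c1x′)
              (bound-split [] (c1 ∷ x′ ∷ x ∷ []) c2
                (bound-in c2 (c1 ∷ x′ ∷ x ∷ []) (c1 ∷ x′ ∷ x ∷ c2′ ∷ c2 ∷ []) u2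
                   (inj₂ (inj₁ (here refl)) ∷ inj₂ (inj₁ (there (here refl))) ∷ inj₂ (inj₁ (there (there (here refl))))
                     ∷ inj₂ (inj₂ (partner-adj mc2)) ∷ inj₁ refl ∷ [])
                   (relax 6 32 (step c1 (x′ ∷ x ∷ c2′ ∷ c2 ∷ []) u1 (c1x′ ∷ A-≢′ a1 ∷ (λ q → ¬P (sym (partner-sym mc2 mc1 q))) ∷ (≢-sym n21) ∷ []) ⨾
                                step-exposed x′ (x ∷ c2′ ∷ c2 ∷ []) (partner-∈ mx) (partner-≢ mx ∷ (λ q → partner-≢-partner mx mc2 (A-≢′ a2) c2x′ (sym q)) ∷ (≢-sym c2x′) ∷ [])
                                    (partner-exposed mx (x ∷ c2′ ∷ c2 ∷ []) (here refl)) ⨾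
                                step x (c2′ ∷ c2 ∷ []) ux ((λ q → partner-≢-other mx mc2 (A-≢′ a2) c2x′ (sym q)) ∷ A-≢ a2 ∷ []) ⨾
                                step-exposed c2′ (c2 ∷ []) (partner-∈ mc2) (partner-≢ mc2 ∷ []) (partner-exposed mc2 (c2 ∷ []) (here refl)) ⨾
                                step c2 [] u2 [])))
                undominated))))
        where c2′ = partner mc2

      module Paired (P : c2 ≡ partner mc1) where
        c1~c2 : A c1 c2 ≡ true
        c1~c2 = subst (λ q → A c1 q ≡ true) (sym P) (partner-adj mc1)
        c2-exposed : ∀ xs → c1 ∈ xs → Exposed (delAll xs U) c2
        c2-exposed xs m = subst (λ q → Exposed (delAll xs U) q) (sym P) (partner-exposed mc1 xs m)
        c1-exposed : ∀ xs → c2 ∈ xs → Exposed (delAll xs U) c1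
        c1-exposed xs m = exposed-without-partner mc1 xs (subst (λ q → q ∈ xs) P m)
        partner-c2 : partner mc2 ≡ c1
        partner-c2 = partner-sym mc1 mc2 P
        x-in : Bound 8 32 (misWith U (x ∷ []) [])
        x-in = bound-in x [] (c2 ∷ c1 ∷ x′ ∷ x ∷ []) ux (inj₂ (inj₂ a2) ∷ inj₂ (inj₂ a1) ∷ inj₂ (inj₂ (partner-adj mx)) ∷ inj₁ refl ∷ [])
            (relax 8 32 (step-exposed c2 (c1 ∷ x′ ∷ x ∷ []) u2 (n21 ∷ c2x′ ∷ A-≢′ a2 ∷ []) (c2-exposed (c1 ∷ x′ ∷ x ∷ []) (here refl)) ⨾
                         step c1 (x′ ∷ x ∷ []) u1 (c1x′ ∷ A-≢′ a1 ∷ []) ⨾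
                         step-exposed x′ (x ∷ []) (partner-∈ mx) (partner-≢ mx ∷ []) (partner-exposed mx (x ∷ []) (here refl)) ⨾
                         step x [] ux []))
        c2-in : Bound 8 32 (misWith U (c2 ∷ []) (c1 ∷ x′ ∷ x ∷ []))
        c2-in = bound-in c2 (c1 ∷ x′ ∷ x ∷ []) (x′ ∷ x ∷ c1 ∷ c2 ∷ []) u2
                 (inj₂ (inj₁ (there (here refl))) ∷ inj₂ (inj₁ (there (there (here refl)))) ∷ inj₂ (inj₁ (here refl)) ∷ inj₁ refl ∷ [])
                 (relax 8 32 (step-exposed x′ (x ∷ c1 ∷ c2 ∷ []) (partner-∈ mx) (partner-≢ mx ∷ (≢-sym c1x′) ∷ (≢-sym c2x′) ∷ []) (partner-exposed mx (x ∷ c1 ∷ c2 ∷ []) (here refl)) ⨾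
                              step x (c1 ∷ c2 ∷ []) ux (A-≢ a1 ∷ A-≢ a2 ∷ []) ⨾
                              step-exposed c1 (c2 ∷ []) u1 ((≢-sym n21) ∷ []) (c1-exposed (c2 ∷ []) (here refl)) ⨾
                              step c2 [] u2 []))
        c1-in : Bound 8 32 (misWith U (c1 ∷ []) (x′ ∷ x ∷ []))
        c1-in = bound-in c1 (x′ ∷ x ∷ []) (x′ ∷ x ∷ c2 ∷ c1 ∷ []) u1
                 (inj₂ (inj₁ (here refl)) ∷ inj₂ (inj₁ (there (here refl))) ∷ inj₂ (inj₂ c1~c2) ∷ inj₁ refl ∷ [])
                 (relax 8 32 (step-exposed x′ (x ∷ c2 ∷ c1 ∷ []) (partner-∈ mx) (partner-≢ mx ∷ (≢-sym c2x′) ∷ (≢-sym c1x′) ∷ []) (partner-exposed mx (x ∷ c2 ∷ c1 ∷ []) (here refl)) ⨾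
                              step x (c2 ∷ c1 ∷ []) ux (A-≢ a2 ∷ A-≢ a1 ∷ []) ⨾
                              step-exposed c2 (c1 ∷ []) u2 (n21 ∷ []) (c2-exposed (c1 ∷ []) (here refl)) ⨾
                              step c1 [] u1 []))
        x-out : Bound 24 32 (misWith U [] (x ∷ []))
        x-out with z1 ≟F x′ | z2 ≟F x′
        ... | no z1x′ | _ = bound-weaken
            (bound-split [] (x ∷ []) x′ (branch-partner-in x mx e1 e2 ux ue1 ae1 ue2 ae2 ne21 e1x e2x)
              (bound-split [] (x′ ∷ x ∷ []) c1
                (bound-in c1 (x′ ∷ x ∷ []) (z1 ∷ x′ ∷ x ∷ c2 ∷ c1 ∷ []) u1
                   (inj₂ (inj₂ az1) ∷ inj₂ (inj₁ (here refl)) ∷ inj₂ (inj₁ (there (here refl))) ∷ inj₂ (inj₂ c1~c2) ∷ inj₁ refl ∷ [])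
                   (relax 6 32 (step z1 (x′ ∷ x ∷ c2 ∷ c1 ∷ []) uz1 (z1x′ ∷ z1x ∷ (λ q → z1c1′ (trans q P)) ∷ A-≢′ az1 ∷ []) ⨾
                                step-exposed x′ (x ∷ c2 ∷ c1 ∷ []) (partner-∈ mx) (partner-≢ mx ∷ (≢-sym c2x′) ∷ (≢-sym c1x′) ∷ []) (partner-exposed mx (x ∷ c2 ∷ c1 ∷ []) (here refl)) ⨾
                                step x (c2 ∷ c1 ∷ []) ux (A-≢ a2 ∷ A-≢ a1 ∷ []) ⨾
                                step-exposed c2 (c1 ∷ []) u2 (n21 ∷ []) (c2-exposed (c1 ∷ []) (here refl)) ⨾
                                step c1 [] u1 [])))
                (bound-split [] (c1 ∷ x′ ∷ x ∷ []) c2 c2-in undominated)))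
        ... | yes z1x′ | no z2x′ = bound-weaken
            (bound-split [] (x ∷ []) x′ (branch-partner-in x mx e1 e2 ux ue1 ae1 ue2 ae2 ne21 e1x e2x)
              (bound-split [] (x′ ∷ x ∷ []) c1 c1-in
                (bound-split [] (c1 ∷ x′ ∷ x ∷ []) c2
                  (bound-in c2 (c1 ∷ x′ ∷ x ∷ []) (z2 ∷ x′ ∷ x ∷ c1 ∷ c2 ∷ []) u2
                     (inj₂ (inj₂ az2) ∷ inj₂ (inj₁ (there (here refl))) ∷ inj₂ (inj₁ (there (there (here refl)))) ∷ inj₂ (inj₁ (here refl)) ∷ inj₁ refl ∷ [])
                     (relax 6 32 (step z2 (x′ ∷ x ∷ c1 ∷ c2 ∷ []) uz2 (z2x′ ∷ z2x ∷ (λ q → z2c2′ (trans q (sym partner-c2))) ∷ A-≢′ az2 ∷ []) ⨾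
                                  step-exposed x′ (x ∷ c1 ∷ c2 ∷ []) (partner-∈ mx) (partner-≢ mx ∷ (≢-sym c1x′) ∷ (≢-sym c2x′) ∷ []) (partner-exposed mx (x ∷ c1 ∷ c2 ∷ []) (here refl)) ⨾
                                  step x (c1 ∷ c2 ∷ []) ux (A-≢ a1 ∷ A-≢ a2 ∷ []) ⨾
                                  step-exposed c1 (c2 ∷ []) u1 ((≢-sym n21) ∷ []) (c1-exposed (c2 ∷ []) (here refl)) ⨾
                                  step c2 [] u2 [])))
                  undominated)))
        ... | yes z1x′ | yes z2x′ =
            bound-split [] (x ∷ []) x′
              (bound-in x′ (x ∷ []) (c2 ∷ c1 ∷ x ∷ x′ ∷ []) (partner-∈ mx)
                 (inj₂ (inj₂ (A-sym-true (subst (λ q → A c2 q ≡ true) z2x′ az2))) ∷ inj₂ (inj₂ (A-sym-true (subst (λ q → A c1 q ≡ true) z1x′ az1)))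
                   ∷ inj₂ (inj₁ (here refl)) ∷ inj₁ refl ∷ [])
                 (relax 8 32 (step-exposed c2 (c1 ∷ x ∷ x′ ∷ []) u2 (n21 ∷ A-≢′ a2 ∷ c2x′ ∷ []) (c2-exposed (c1 ∷ x ∷ x′ ∷ []) (here refl)) ⨾
                              step c1 (x ∷ x′ ∷ []) u1 (A-≢′ a1 ∷ c1x′ ∷ []) ⨾
                              step-exposed x (x′ ∷ []) ux ((λ q → partner-≢ mx (sym q)) ∷ []) (exposed-without-partner mx (x′ ∷ []) (here refl)) ⨾
                              step x′ [] (partner-∈ mx) [])))
              (bound-split [] (x′ ∷ x ∷ []) c1 c1-in
                (bound-split [] (c1 ∷ x′ ∷ x ∷ []) c2 c2-in undominated))

        bound : misIn U * K ≤ Φ U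
        bound = bound-total {32} {32} (bound-split [] [] x x-in x-out)

      bound : misIn U * K ≤ Φ U
      bound with c2 ≟F partner mc1
      ... | no ¬P = unpaired ¬P
      ... | yes P = Paired.bound P

    Exposed? : ∀ x → Dec (Exposed U x)
    Exposed? x = all? (λ i → hits U x i ≟B false)

    matched-if-unexposed : ∀ y → ¬ Exposed U y → Matched y
    matched-if-unexposed y nl with any? (λ i → hits U y i ≟B true)
    ... | yes (i , h) = matched i h
    ... | no nh = ⊥-elim (nl (λ i → ≢true⇒≡false (λ e → nh (i , e))))

    empty-case : (∀ z → U z ≡ false) → misIn U * K ≤ Φ U
    empty-case empty = begin
      misIn U * K                    ≤⟨ *-monoˡ-≤ K (misIn-empty≤1 U empty) ⟩
      1 * K                          ≡⟨ +-identityʳ K ⟩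
      2 ^ n * 9 ^ f                  ≡⟨ cong₂ _*_ (vertexWeight-const U false empty) no-full-pair ⟨
      vertexWeight U * pairWeight U  ∎
      where
      open ≤-Reasoning
      no-full-pair : pairWeight U ≡ 9 ^ f
      no-full-pair = trans (prodFin-cong f (λ i → cong (λ q → if q ∧ U (b i) then 8 else 9) (empty (a i))))
                           (prodFin-const f 9)

    NbrIn : Fin n → Fin n → Set
    NbrIn v r = U r ≡ true × A v r ≡ true

    ThreeNbrsOf : Fin n → Set
    ThreeNbrsOf v = Σ (Fin n) λ y1 → Σ (Fin n) λ y2 → Σ (Fin n) λ y3 → All (NbrIn v) (list3 y1 y2 y3) × y2 ≢ y1 × y3 ≢ y2 × y3 ≢ y1

    three-nbrs : ∀ v → HasNbrs U 3 v [] → ThreeNbrsOf v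
    three-nbrs v (y1 , (u1 , a1 , []) , y2 , (u2 , a2 , n21 ∷ []) , y3 , (u3 , a3 , n32 ∷ n31 ∷ []) , tt) =
      y1 , y2 , y3 , ((u3 , a3) ∷ (u2 , a2) ∷ (u1 , a1) ∷ []) , n21 , n32 , n31

    has-nbrs : ∀ k x → ¬ (Σ (Fin n) λ a → U a ≡ true × ¬ HasNbrs U k a []) → U x ≡ true → HasNbrs U k x []
    has-nbrs k x ng ux with HasNbrs? U k x []
    ... | yes h = h
    ... | no nh = ⊥-elim (ng (x , ux , nh))

    exposed-case : ∀ x → U x ≡ true → Exposed U x → (∀ y → U y ≡ true → A x y ≡ true → Matched y) → misIn U * K ≤ Φ U
    exposed-case x ux ex nbrs-matched with any? (NewNbr? U x [])
    ... | no h = exposed-isolated x ux ex (λ y uy axy → h (y , uy , axy , []))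
    ... | yes (y1 , u1 , a1 , _) with any? (NewNbr? U x (y1 ∷ []))
    ...   | no h = exposed-one-nbr x y1 ux ex u1 a1 (nbrs-matched y1 u1 a1) (λ y uy axy → one (nbrs-listed U x (y1 ∷ []) h y uy axy))
      where one : ∀ {y} → y ∈ (y1 ∷ []) → y ≡ y1
            one (here e) = e
    ...   | yes (y2 , u2 , a2 , n21 ∷ []) with any? (NewNbr? U x (y2 ∷ y1 ∷ []))
    ...     | yes (y3 , u3 , a3 , n32 ∷ n31 ∷ []) = exposed-three-nbrs x y1 y2 y3 ux ex u1 a1 u2 a2 u3 a3 n21 n32 n31
    ...     | no h = exposed-two-nbrs x y1 y2 ux ex u1 a1 u2 a2 n21 (nbrs-matched y1 u1 a1) (nbrs-matched y2 u2 a2) (nbrs-listed U x (y2 ∷ y1 ∷ []) h)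

    matched-degree-two : ∀ x → U x ≡ true → (mx : Matched x) → ∀ y1 y2 → U y1 ≡ true → A x y1 ≡ true → U y2 ≡ true → A x y2 ≡ true → y2 ≢ y1 →
            (∀ y → U y ≡ true → A x y ≡ true → y ∈ (y2 ∷ y1 ∷ [])) → (∀ c → U c ≡ true → Matched c) →
            ∀ e → U e ≡ true → A (partner mx) e ≡ true → e ≢ x → misIn U * K ≤ Φ U
    matched-degree-two x ux mx y1 y2 u1 a1 u2 a2 n21 nb all-matched e ue ae ex with nb (partner mx) (partner-∈ mx) (partner-adj mx)
    ... | here eq = matched-two-nbrs x y1 e ux mx u1 a1 (λ q → n21 (trans (sym eq) (sym q))) (all-matched y1 u1) ue ae ex
                      (λ y uy axy → sw (nb y uy axy))
      where sw : ∀ {y} → y ∈ (y2 ∷ y1 ∷ []) → y ∈ (y1 ∷ partner mx ∷ [])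
            sw (here q) = there (here (trans q (sym eq)))
            sw (there (here q)) = here q
    ... | there (here eq) = matched-two-nbrs x y2 e ux mx u2 a2 (λ q → n21 (trans q eq)) (all-matched y2 u2) ue ae ex
                      (λ y uy axy → sw (nb y uy axy))
      where sw : ∀ {y} → y ∈ (y2 ∷ y1 ∷ []) → y ∈ (y2 ∷ partner mx ∷ [])
            sw (here q) = here q
            sw (there (here q)) = there (here (trans q (sym eq)))

    matched-cubic : ∀ x → U x ≡ true → (mx : Matched x) → (h : ThreeNbrsOf x) →
           (∀ y → U y ≡ true → A x y ≡ true → y ∈ list3 (proj₁ h) (proj₁ (proj₂ h)) (proj₁ (proj₂ (proj₂ h)))) →
           (∀ c → U c ≡ true → Matched c) → (∀ v → U v ≡ true → ThreeNbrsOf v) → misIn U * K ≤ Φ U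
    matched-cubic x ux mx (y1 , y2 , y3 , fa , n21 , n32 , n31) nb all-matched h3
      with split-3 y1 y2 y3 (partner mx) n21 n32 n31 (nb (partner mx) (partner-∈ mx) (partner-adj mx))
    ... | (c1 , c2 , m1 , m2 , n , c1x′ , c2x′ , sub)
      with h3 (partner mx) (partner-∈ mx) | h3 c1 (proj₁ (All.lookup fa m1)) | h3 c2 (proj₁ (All.lookup fa m2))
    ... | (f1 , f2 , f3 , ff , o21 , o32 , o31) | (g1 , g2 , g3 , gg , p21 , p32 , p31) | (k1 , k2 , k3 , kk , q21 , q32 , q31)
      with pick-2-of-3 f1 f2 f3 x o21 o32 o31
         | pick-1-of-3 g1 g2 g3 (partner (all-matched c1 (proj₁ (All.lookup fa m1)))) x p21 p32 p31
         | pick-1-of-3 k1 k2 k3 (partner (all-matched c2 (proj₁ (All.lookup fa m2)))) x q21 q32 q31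
    ... | (e1 , e2 , me1 , me2 , ne21 , e1x , e2x) | (z1 , mz1 , z1c1′ , z1x) | (z2 , mz2 , z2c2′ , z2x) =
      ThreeNbrs.bound x c1 c2 e1 e2 z1 z2 ux mx
        (proj₁ (All.lookup fa m1)) (proj₂ (All.lookup fa m1)) (proj₁ (All.lookup fa m2)) (proj₂ (All.lookup fa m2)) n c1x′ c2x′
        (all-matched c1 (proj₁ (All.lookup fa m1))) (all-matched c2 (proj₁ (All.lookup fa m2)))
        (λ y uy axy → sub (nb y uy axy))
        (proj₁ (All.lookup ff me1)) (proj₂ (All.lookup ff me1)) (proj₁ (All.lookup ff me2)) (proj₂ (All.lookup ff me2)) ne21 e1x e2x
        (proj₁ (All.lookup gg mz1)) (proj₂ (All.lookup gg mz1)) z1c1′ z1x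
        (proj₁ (All.lookup kk mz2)) (proj₂ (All.lookup kk mz2)) z2c2′ z2x

    -- Pick x of degree ≥ 4, else of degree 1, else of degree 2; otherwise G[U] is cubic.
    matched-case : (∀ x → U x ≡ true → Matched x) → ∀ z0 → U z0 ≡ true → misIn U * K ≤ Φ U
    matched-case all-matched z0 uz0 with any? (λ a → (U a ≟B true) ×-dec HasNbrs? U 4 a [])
    ... | yes (x , ux , (y1 , (u1 , a1 , []) , y2 , (u2 , a2 , n21 ∷ []) , y3 , (u3 , a3 , n32 ∷ n31 ∷ []) , y4 , (u4 , a4 , n43 ∷ n42 ∷ n41 ∷ []) , tt))
      with pick-3-of-4 y1 y2 y3 y4 (partner (all-matched x ux)) n21 n32 n31 n43 n42 n41
    ...   | (r1 , r2 , r3 , m1 , m2 , m3 , q21 , q32 , q31 , p1 , p2 , p3) =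
        matched-four-nbrs x r1 r2 r3 ux (all-matched x ux) (proj₁ (All.lookup fa m1)) (proj₂ (All.lookup fa m1))
          (proj₁ (All.lookup fa m2)) (proj₂ (All.lookup fa m2)) (proj₁ (All.lookup fa m3)) (proj₂ (All.lookup fa m3))
          q21 q32 q31 p1 p2 p3
      where fa : All (NbrIn x) (list4 y1 y2 y3 y4)
            fa = (u4 , a4) ∷ (u3 , a3) ∷ (u2 , a2) ∷ (u1 , a1) ∷ []
    matched-case all-matched z0 uz0 | no ¬g4 with any? (λ a → (U a ≟B true) ×-dec ¬? (HasNbrs? U 2 a []))
    ... | yes (x , ux , ¬h2) = matched-one-nbr x ux mx (λ y uy axy → one (nbrs-listed U x (partner mx ∷ []) (λ (y′ , nb′) → ¬h2 (partner mx , (partner-∈ mx , partner-adj mx , []) , y′ , nb′ , tt)) y uy axy))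
      where mx = all-matched x ux
            one : ∀ {y} → y ∈ (partner mx ∷ []) → y ≡ partner mx
            one (here e) = e
    ... | no ¬g1 with any? (λ a → (U a ≟B true) ×-dec ¬? (HasNbrs? U 3 a []))
    ...   | yes (x , ux , ¬h3) with has-nbrs 2 x ¬g1 ux | has-nbrs 2 (partner (all-matched x ux)) ¬g1 (partner-∈ (all-matched x ux))
    ...     | (y1 , (u1 , a1 , []) , y2 , (u2 , a2 , n21 ∷ []) , tt) | (f1 , (v1 , b1 , []) , f2 , (v2 , b2 , o21 ∷ []) , tt)
      with pick-1-of-2 f1 f2 x o21
    ...       | (e , here refl , ex) = matched-degree-two x ux (all-matched x ux) y1 y2 u1 a1 u2 a2 n21
                    (nbrs-listed U x (y2 ∷ y1 ∷ []) (λ (y , nb) → ¬h3 (y1 , (u1 , a1 , []) , y2 , (u2 , a2 , n21 ∷ []) , y , nb , tt)))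
                    all-matched e v2 b2 ex
    ...       | (e , there (here refl) , ex) = matched-degree-two x ux (all-matched x ux) y1 y2 u1 a1 u2 a2 n21
                    (nbrs-listed U x (y2 ∷ y1 ∷ []) (λ (y , nb) → ¬h3 (y1 , (u1 , a1 , []) , y2 , (u2 , a2 , n21 ∷ []) , y , nb , tt)))
                    all-matched e v1 b1 ex
    matched-case all-matched z0 uz0 | no ¬g4 | no ¬g1 | no ¬g2 with has-nbrs 3 z0 ¬g2 uz0
    ... | (y1 , (u1 , a1 , []) , y2 , (u2 , a2 , n21 ∷ []) , y3 , (u3 , a3 , n32 ∷ n31 ∷ []) , tt) =
      matched-cubic z0 uz0 (all-matched z0 uz0) (y1 , y2 , y3 , ((u3 , a3) ∷ (u2 , a2) ∷ (u1 , a1) ∷ []) , n21 , n32 , n31)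
        (nbrs-listed U z0 (y3 ∷ y2 ∷ y1 ∷ []) (λ (y , nb) → ¬g4 (z0 , uz0 , (y1 , (u1 , a1 , []) , y2 , (u2 , a2 , n21 ∷ []) , y3 , (u3 , a3 , n32 ∷ n31 ∷ []) , y , nb , tt))))
        all-matched (λ v uv → three-nbrs v (has-nbrs 3 v ¬g2 uv))

  -- The induction for the matching bound runs on size U and, for equal sizes, on the number of exposed
  -- vertices: adding an edge between two exposed vertices to the matching lowers the latter.
  measure : ∀ f (a b : Fin f → Fin n) (adjab : ∀ i → A (a i) (b i) ≡ true) → VSet n → ℕ
  measure f a b adjab U = size U * suc n + Matching.#exposed f a b adjab U

  measure-< : ∀ f a b adjab V U → size V < size U → measure f a b adjab V < measure f a b adjab U
  measure-< f a b adjab V U lt = begin-strict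
    size V * suc n + #exposed V  <⟨ +-monoʳ-< (size V * suc n) (s≤s (#exposed≤n V)) ⟩
    size V * suc n + suc n       ≡⟨ +-comm (size V * suc n) (suc n) ⟩
    suc (size V) * suc n         ≤⟨ *-monoˡ-≤ (suc n) lt ⟩
    size U * suc n               ≤⟨ m≤m+n (size U * suc n) (#exposed U) ⟩
    size U * suc n + #exposed U  ∎
    where
    open ≤-Reasoning
    open Matching f a b adjab

  module Augmented (f : ℕ) (a b : Fin f → Fin n) (adjab : ∀ i → A (a i) (b i) ≡ true) (U : VSet n)
      (d : Matching.Disjoint f a b adjab U) (x y : Fin n) (ux : U x ≡ true) (uy : U y ≡ true)
      (ex : Matching.Exposed f a b adjab U x) (ey : Matching.Exposed f a b adjab U y) (axy : A x y ≡ true) where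
    open Matching f a b adjab

    adj′ : ∀ i → A ((x ∷ᶠ a) i) ((y ∷ᶠ b) i) ≡ true
    adj′ zero    = axy
    adj′ (suc i) = adjab i

    module M′ = Matching (suc f) (x ∷ᶠ a) (y ∷ᶠ b) adj′

    hits-new : ∀ z → M′.hits U z zero ≡ true → z ≡ x ⊎ z ≡ y
    hits-new z e with eqb z x in e₁
    ... | true  = inj₁ (eqb-true⁻ e₁)
    ... | false = inj₂ (eqb-true⁻ (∧-true-r {U x ∧ U y} e))

    not-hits-old : ∀ z i → M′.hits U z zero ≡ true → hits U z i ≡ true → ⊥
    not-hits-old z i h₀ h with hits-new z h₀
    ... | inj₁ refl = true≢false (trans (sym h) (ex i))
    ... | inj₂ refl = true≢false (trans (sym h) (ey i))

    disjoint′ : M′.Disjoint U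
    disjoint′ z zero    zero    h₁ h₂ = refl
    disjoint′ z (suc i) (suc j) h₁ h₂ = cong suc (d z i j h₁ h₂)
    disjoint′ z zero    (suc j) h₁ h₂ = ⊥-elim (not-hits-old z j h₁ h₂)
    disjoint′ z (suc i) zero    h₁ h₂ = ⊥-elim (not-hits-old z i h₂ h₁)

    fewer-exposed : M′.#exposed U < #exposed U
    fewer-exposed = sumFin-mono-< n x pointwise strict
      where
      drop : ∀ u h r → χ (u ∧ not (h ∨ r)) ≤ χ (u ∧ not r)
      drop true  true  r     = z≤n
      drop true  false true  = z≤n
      drop true  false false = ≤-refl
      drop false h     r     = z≤n
      pointwise : ∀ z → χ (U z ∧ not (anyFin (suc f) (M′.hits U z))) ≤ χ (U z ∧ not (anyFin f (hits U z)))
      pointwise z = drop (U z) (M′.hits U z zero) (anyFin f (hits U z))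
      strict : χ (U x ∧ not (anyFin (suc f) (M′.hits U x))) < χ (U x ∧ not (anyFin f (hits U x)))
      strict rewrite ux | uy | eqb-refl x | anyFin-false f (hits U x) ex = s≤s z≤n

    Φ′≡8Φ : M′.Φ U ≡ 8 * Φ U
    Φ′≡8Φ rewrite ux | uy = swap (vertexWeight U) (pairWeight U)
      where
      swap : ∀ p q → p * (8 * q) ≡ 8 * (p * q)
      swap = solve-∀

  matching-bound : ∀ (M f : ℕ) (a b : Fin f → Fin n) (adjab : ∀ i → A (a i) (b i) ≡ true) (U : VSet n) →
    Matching.Disjoint f a b adjab U → measure f a b adjab U < M →
    misIn U * (2 ^ n * 9 ^ f) ≤ Matching.Φ f a b adjab U
  matching-bound (suc M) f a b adjab U d (s≤s sM) = main
    where
    open Matching f a b adjab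
    IH : ∀ V → V ⊆ U → ∀ x → U x ≡ true → V x ≡ false → misIn V * (2 ^ n * 9 ^ f) ≤ Φ V
    IH V s x ux vx = matching-bound M f a b adjab V (Disjoint-mono s d)
                       (≤-trans (measure-< f a b adjab V U (size-< V U x s ux vx)) sM)
    open MatchingCases f a b adjab U d IH

    -- The extended matching has one more full pair (weight 8 instead of 9) and K grows by a factor 9.
    augment : ∀ x y → U x ≡ true → Exposed U x → U y ≡ true → Exposed U y → A x y ≡ true → misIn U * K ≤ Φ U
    augment x y ux ex uy ey axy = *-cancelˡ-≤ 9 (begin
      9 * (misIn U * K)                   ≡⟨ shuffle (misIn U) (2 ^ n) (9 ^ f) ⟩
      misIn U * (2 ^ n * 9 ^ suc f)       ≤⟨ matching-bound M (suc f) _ _ adj′ U disjoint′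
                                               (≤-trans (+-monoʳ-< (size U * suc n) fewer-exposed) sM) ⟩
      M′.Φ U                              ≡⟨ Φ′≡8Φ ⟩
      8 * Φ U                             ≤⟨ *-monoˡ-≤ (Φ U) (≤ᵇ⇒≤ 8 9 _) ⟩
      9 * Φ U                             ∎)
      where
      open Augmented f a b adjab U d x y ux uy ex ey axy
      open ≤-Reasoning
      shuffle : ∀ c p q → 9 * (c * (p * q)) ≡ c * (p * (9 * q))
      shuffle = solve-∀

    main : misIn U * K ≤ Φ U
    main with any? (λ z → U z ≟B true)
    ... | no none = empty-case (λ z → ≢true⇒≡false (λ e → none (z , e)))
    ... | yes (z₀ , uz₀) with any? (λ x → any? (λ y → ((U x ≟B true) ×-dec Exposed? x) ×-dec (((U y ≟B true) ×-dec Exposed? y) ×-dec (A x y ≟B true))))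
    ...   | yes (x , y , (ux , ex) , (uy , ey) , axy) = augment x y ux ex uy ey axy
    ...   | no no-exposed-edge with any? (λ x → (U x ≟B true) ×-dec Exposed? x)
    ...     | yes (x , ux , ex) = exposed-case x ux ex (λ y uy axy → matched-if-unexposed y (λ ey → no-exposed-edge (x , y , (ux , ex) , (uy , ey) , axy)))
    ...     | no none-exposed = matched-case (λ x ux → matched-if-unexposed x (λ ex → none-exposed (x , ux , ex))) z₀ uz₀

  -- Pair idx c i is the rung u_i v_i of copy c.
  module CopyPotential (f : ℕ) (a b : Fin f → Fin n) (adjab : ∀ i → A (a i) (b i) ≡ true)
     (k ℓ : ℕ) (idx : Fin k → Fin ℓ → Fin f)
     (covers-unique : ∀ x i j → Matching.covers f a b adjab i x ≡ true → Matching.covers f a b adjab j x ≡ true → i ≡ j)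
     (idx-injective : ∀ c i c′ j → idx c i ≡ idx c′ j → c ≡ c′ × i ≡ j) where
    open Matching f a b adjab

    intact : Fin k → VSet n → Bool
    intact c U = allFin ℓ (λ i → full U (idx c i))

    inCopy : Fin k → Fin n → Bool
    inCopy c x = anyFin ℓ (λ i → covers (idx c i) x)

    intact-del : ∀ x U c → intact c (del x U) ≡ intact c U ∧ not (inCopy c x)
    intact-del x U c = trans (allFin-cong ℓ (λ i → full-del x U (idx c i))) (allFin-∧-not ℓ _ _)

    intact-cong : ∀ {U V} → (∀ z → U z ≡ V z) → ∀ c → intact c U ≡ intact c V
    intact-cong e c = allFin-cong ℓ (λ i → cong₂ _∧_ (e (a (idx c i))) (e (b (idx c i))))

    copyWeight : VSet n → ℕ
    copyWeight U = prodFin k (λ c → if intact c U then 31 else 32)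

    copyWeight-cong : ∀ {U V} → (∀ z → U z ≡ V z) → copyWeight U ≡ copyWeight V
    copyWeight-cong e = prodFin-cong k (λ c → cong (λ q → if q then 31 else 32) (intact-cong e c))

    ΦT : VSet n → ℕ
    ΦT U = Φ U * copyWeight U

    ΦT-cong : ∀ {U V} → (∀ z → U z ≡ V z) → ΦT U ≡ ΦT V
    ΦT-cong e = cong₂ _*_ (Φ-cong e) (copyWeight-cong e)

    #intactHits : VSet n → Fin n → ℕ
    #intactHits U x = sumFin k (λ c → χ (intact c U ∧ inCopy c x))

    copyWeight-del : ∀ x U → copyWeight (del x U) * 31 ^ #intactHits U x ≡ copyWeight U * 32 ^ #intactHits U x
    copyWeight-del x U = prodFin-if-update k (λ c → intact c U) (λ c → intact c (del x U)) (λ c → inCopy c x) 31 32 (intact-del x U)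

    OutsideIntact : VSet n → Fin n → Set
    OutsideIntact W x = ∀ c → (intact c W ∧ inCopy c x) ≡ false

    disjoint : ∀ U → Disjoint U
    disjoint U x i j h₁ h₂ = covers-unique x i j (∧-true-r {full U i} h₁) (∧-true-r {full U j} h₂)

    inCopy-unique : ∀ x c c′ → inCopy c x ≡ true → inCopy c′ x ≡ true → c ≡ c′
    inCopy-unique x c c′ m₁ m₂ with anyFin-true⁻ ℓ _ m₁ | anyFin-true⁻ ℓ _ m₂
    ... | i , e₁ | j , e₂ = proj₁ (idx-injective c i c′ j (covers-unique x _ _ e₁ e₂))

    copyWeight-del-ratio : ∀ x U → 31 * copyWeight (del x U) ≤ 32 * copyWeight U
    copyWeight-del-ratio x U with ≤1-cases (#intactHits U x) #intactHits≤1 | copyWeight-del x U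
      where
      #intactHits≤1 : #intactHits U x ≤ 1
      #intactHits≤1 = sumFin-χ-≤1 k _ (λ c c′ e₁ e₂ → inCopy-unique x c c′ (∧-true-r {intact c U} e₁) (∧-true-r {intact c′ U} e₂))
    ... | inj₁ e | h rewrite e | *-identityʳ (copyWeight (del x U)) | *-identityʳ (copyWeight U) | h =
      *-monoˡ-≤ (copyWeight U) (≤ᵇ⇒≤ 31 32 _)
    ... | inj₂ e | h rewrite e = ≤-reflexive (trans (*-comm 31 (copyWeight (del x U))) (trans h (*-comm (copyWeight U) 32)))

    copyWeight-del-outside : ∀ x U → OutsideIntact U x → copyWeight (del x U) ≡ copyWeight U
    copyWeight-del-outside x U out
      with copyWeight-del x U
    ... | h rewrite sumFin-zero k (cong χ ∘ out) = trans (sym (*-identityʳ _)) (trans h (*-identityʳ _))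

    -- (3/4)(32/31) = 24/31
    ΦT-del-ratio : ∀ x W → W x ≡ true → 31 * ΦT (del x W) ≤ 24 * ΦT W
    ΦT-del-ratio x W wx = *-cancelˡ-≤ 4 (begin
      4 * (31 * (Φ (del x W) * copyWeight (del x W)))  ≡⟨ shuffle₁ (Φ (del x W)) (copyWeight (del x W)) ⟩
      (4 * Φ (del x W)) * (31 * copyWeight (del x W))  ≤⟨ *-mono-≤ (Φ-del-ratio x W wx (disjoint W)) (copyWeight-del-ratio x W) ⟩
      (3 * Φ W) * (32 * copyWeight W)                  ≡⟨ shuffle₂ (Φ W) (copyWeight W) ⟩
      4 * (24 * (Φ W * copyWeight W))                  ∎)
      where
      open ≤-Reasoning
      shuffle₁ : ∀ p q → 4 * (31 * (p * q)) ≡ (4 * p) * (31 * q)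
      shuffle₁ = solve-∀
      shuffle₂ : ∀ p q → (3 * p) * (32 * q) ≡ 4 * (24 * (p * q))
      shuffle₂ = solve-∀

    ΦT-del-outside : ∀ x W → W x ≡ true → OutsideIntact W x → 4 * ΦT (del x W) ≤ 3 * ΦT W
    ΦT-del-outside x W wx out rewrite copyWeight-del-outside x W out =
      subst₂ _≤_ (*-assoc 4 (Φ (del x W)) (copyWeight W)) (*-assoc 3 (Φ W) (copyWeight W))
        (*-monoˡ-≤ (copyWeight W) (Φ-del-ratio x W wx (disjoint W)))

    ΦT-del-outside-exposed : ∀ x W → W x ≡ true → OutsideIntact W x → Exposed W x → 3 * ΦT (del x W) ≡ 2 * ΦT W
    ΦT-del-outside-exposed x W wx out exp rewrite copyWeight-del-outside x W out =
      trans (sym (*-assoc 3 (Φ (del x W)) (copyWeight W)))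
        (trans (cong (_* copyWeight W) (Φ-del-exposed x W wx exp)) (*-assoc 2 (Φ W) (copyWeight W)))

    ΦT-del-≤ : ∀ x W → ΦT (del x W) ≤ ΦT W
    ΦT-del-≤ x W with W x in eq
    ... | true  = *-cancelˡ-≤ 24 (≤-trans (*-monoˡ-≤ (ΦT (del x W)) (≤ᵇ⇒≤ 24 31 _)) (ΦT-del-ratio x W eq))
    ... | false = ≤-reflexive (ΦT-cong (del-absent x W eq))

    ΦT-fullSet : ΦT fullSet ≡ 3 ^ n * 8 ^ f * 31 ^ k
    ΦT-fullSet = cong₂ _*_ (cong₂ _*_ (vertexWeight-const fullSet true (λ _ → refl)) (prodFin-const f 8))
                   (trans (prodFin-cong k (λ c → cong (λ q → if q then 31 else 32) (allFin-true ℓ _ (λ _ → refl))))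
                          (prodFin-const k 31))

    ΦT-mono : ∀ V U → V ⊆ U → ΦT V ≤ ΦT U
    ΦT-mono V U = ⊆-mono-by-del ΦT ΦT-cong U (λ x W _ → ΦT-del-≤ x W) V

  module CopyBound (f : ℕ) (a b : Fin f → Fin n) (adjab : ∀ i → A (a i) (b i) ≡ true)
     (k ℓ′ : ℕ) (idx : Fin k → Fin (3 + ℓ′) → Fin f)
     (covers-unique : ∀ x i j → Matching.covers f a b adjab i x ≡ true → Matching.covers f a b adjab j x ≡ true → i ≡ j)
     (idx-injective : ∀ c i c′ j → idx c i ≡ idx c′ j → c ≡ c′ × i ≡ j)
     (cycle-adj : ∀ c side i j → CycNext i j →
                  A (if side then b (idx c i) else a (idx c i)) (if side then b (idx c j) else a (idx c j)) ≡ true)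
     where
    ℓ : ℕ
    ℓ = 3 + ℓ′
    open Matching f a b adjab
    open CopyPotential f a b adjab k ℓ idx covers-unique idx-injective public

    copyVertex : Fin k → Bool → Fin ℓ → Fin n
    copyVertex c bb i = if bb then b (idx c i) else a (idx c i)

    covers-copyVertex : ∀ c bb i → covers (idx c i) (copyVertex c bb i) ≡ true
    covers-copyVertex c true  i rewrite eqb-refl (b (idx c i)) = ∨-zeroʳ (eqb (b (idx c i)) (a (idx c i)))
    covers-copyVertex c false i rewrite eqb-refl (a (idx c i)) = refl

    copyVertex-rung : ∀ c bs bt i → bs ≢ bt → A (copyVertex c bs i) (copyVertex c bt i) ≡ true
    copyVertex-rung c false false i ne = ⊥-elim (ne refl)
    copyVertex-rung c false true  i ne = adjab (idx c i)
    copyVertex-rung c true  false i ne = A-sym-true (adjab (idx c i))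
    copyVertex-rung c true  true  i ne = ⊥-elim (ne refl)

    copyVertex-injective : ∀ c bb bb′ i j → (bb ≢ bb′ ⊎ i ≢ j) → copyVertex c bb i ≢ copyVertex c bb′ j
    copyVertex-injective c bb bb′ i j h eq
      with idx-injective c i c j (covers-unique (copyVertex c bb i) (idx c i) (idx c j) (covers-copyVertex c bb i)
                                   (subst (λ q → covers (idx c j) q ≡ true) (sym eq) (covers-copyVertex c bb′ j)))
    ... | _ , refl with h
    ...   | inj₂ ne = ne refl
    ...   | inj₁ ne = ends-differ bb bb′ ne eq
      where
      ends-differ : ∀ bb bb′ → bb ≢ bb′ → copyVertex c bb i ≢ copyVertex c bb′ i
      ends-differ false false ne _ = ne refl
      ends-differ true  true  ne _ = ne refl
      ends-differ false true  ne e = A-≢ (adjab (idx c i)) e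
      ends-differ true  false ne e = A-≢′ (adjab (idx c i)) e

    intact-∈ : ∀ c U → intact c U ≡ true → ∀ bb i → U (copyVertex c bb i) ≡ true
    intact-∈ c U ic true i = ∧-true-r {U (a (idx c i))} (allFin-true⁻ ℓ (λ j → full U (idx c j)) ic i)
    intact-∈ c U ic false i = ∧-true-l {U (a (idx c i))} (allFin-true⁻ ℓ (λ j → full U (idx c j)) ic i)

    inCopy-copyVertex : ∀ c bb i → inCopy c (copyVertex c bb i) ≡ true
    inCopy-copyVertex c bb i = anyFin-true ℓ (λ j → covers (idx c j) (copyVertex c bb i)) i (covers-copyVertex c bb i)

    i0 i1 i2 iL : Fin ℓ
    i0 = zero
    i1 = suc zero
    i2 = suc (suc zero)
    iL = fromℕ (suc (suc ℓ′))

    c01 : CycNext i0 i1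
    c01 = inj₁ refl
    c12 : CycNext i1 i2
    c12 = inj₁ refl
    cL0 : CycNext iL i0
    cL0 = inj₂ (cong suc (toℕ-fromℕ (suc (suc ℓ′))) , refl)

    n01 : i0 ≢ i1
    n01 ()
    n0L : i0 ≢ iL
    n0L ()
    n1L : i1 ≢ iL
    n1L ()
    n20 : i2 ≢ i0
    n20 ()
    n21 : i2 ≢ i1
    n21 ()

    K′ : ℕ
    K′ = 2 ^ n * 9 ^ f * 32 ^ k

    -- Without intact copies ΦT = 32^k Φ and the matching bound applies.
    no-intact-copy : ∀ U → (∀ c → intact c U ≡ false) → misIn U * K′ ≤ ΦT U
    no-intact-copy U none = begin
      misIn U * K′                          ≡⟨ *-assoc (misIn U) (2 ^ n * 9 ^ f) (32 ^ k) ⟨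
      misIn U * (2 ^ n * 9 ^ f) * 32 ^ k    ≤⟨ *-monoˡ-≤ (32 ^ k) (matching-bound (suc (measure f a b adjab U)) f a b adjab U (disjoint U) ≤-refl) ⟩
      Φ U * 32 ^ k                          ≡⟨ cong (Φ U *_) all-32 ⟨
      ΦT U                                  ∎
      where
      open ≤-Reasoning
      all-32 : copyWeight U ≡ 32 ^ k
      all-32 = trans (prodFin-cong k (λ c → cong (λ q → if q then 31 else 32) (none c))) (prodFin-const k 32)

    -- Branch on the ends s₀, t₀ of the first rung of the intact copy c.
    module IntactCopyCases (U : VSet n) (c : Fin k) (ic : intact c U ≡ true)
        (IH : ∀ V → V ⊆ U → ∀ x → U x ≡ true → V x ≡ false → misIn V * K′ ≤ ΦT V) where
      open Branching U ΦT K′ IH (λ V W V⊆W _ → ΦT-mono V W V⊆W)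

      stepT : ∀ x xs → U x ≡ true → All (x ≢_) xs → Ratio≤ 24 31 (delAll (x ∷ xs) U) (delAll xs U)
      stepT x xs ux ne = mkR (ΦT-del-ratio x (delAll xs U) (delAll-intro xs ux (All.lookup ne)))
      stepT-outside : ∀ x xs → U x ≡ true → All (x ≢_) xs → OutsideIntact (delAll xs U) x → Ratio≤ 3 4 (delAll (x ∷ xs) U) (delAll xs U)
      stepT-outside x xs ux ne ni = mkR (ΦT-del-outside x (delAll xs U) (delAll-intro xs ux (All.lookup ne)) ni)
      stepT-outside-exposed : ∀ x xs → U x ≡ true → All (x ≢_) xs → OutsideIntact (delAll xs U) x → Exposed (delAll xs U) x → Ratio≤ 2 3 (delAll (x ∷ xs) U) (delAll xs U)
      stepT-outside-exposed x xs ux ne ni l = mkR (≤-reflexive (ΦT-del-outside-exposed x (delAll xs U) (delAll-intro xs ux (All.lookup ne)) ni l))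


      -- Copies are vertex disjoint, and c itself is no longer intact.
      outside-after : ∀ bb i bb′ j xs → copyVertex c bb′ j ∈ xs → OutsideIntact (delAll xs U) (copyVertex c bb i)
      outside-after bb i bb′ j xs m c′ with intact c′ (delAll xs U) in intact-c′ | inCopy c′ (copyVertex c bb i) in in-c′
      ... | true  | true  = ⊥-elim (broken (inCopy-unique (copyVertex c bb i) c′ c in-c′ (inCopy-copyVertex c bb i)) intact-c′)
        where
        broken : c′ ≡ c → intact c′ (delAll xs U) ≡ true → ⊥
        broken refl ic′ = true≢false (trans (sym (intact-∈ c (delAll xs U) ic′ bb′ j))
                            (≢true-at (delAll xs U) (copyVertex c bb′ j) (λ e → delAll-∉ xs e m refl)))
      ... | true  | false = refl
      ... | false | _     = refl

      exposed-after : ∀ bb i bb′ xs → copyVertex c bb′ i ∈ xs → Exposed (delAll xs U) (copyVertex c bb i)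
      exposed-after bb i bb′ xs m = Exposed-mono (delAll-⊆-del (copyVertex c bb′ i) xs m) (copyVertex c bb i)
         (Exposed-del-partner U (copyVertex c bb i) (copyVertex c bb′ i) (idx c i) (disjoint U)
            (∧-true (allFin-true⁻ ℓ (λ j → full U (idx c j)) ic i) (covers-copyVertex c bb i)) (covers-copyVertex c bb′ i))

      copy-∈ : ∀ bb i → U (copyVertex c bb i) ≡ true
      copy-∈ = intact-∈ c U ic


      module Side (bs bt : Bool) (nst : bs ≢ bt) where
        s t : Fin ℓ → Fin n
        s = copyVertex c bs
        t = copyVertex c bt
        nts : bt ≢ bs
        nts e = nst (sym e)
        As0t0 : A (s i0) (t i0) ≡ true
        As0t0 = copyVertex-rung c bs bt i0 nst
        As0s1 : A (s i0) (s i1) ≡ true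
        As0s1 = cycle-adj c bs i0 i1 c01
        As0sL : A (s i0) (s iL) ≡ true
        As0sL = A-sym-true (cycle-adj c bs iL i0 cL0)
        At0t1 : A (t i0) (t i1) ≡ true
        At0t1 = cycle-adj c bt i0 i1 c01
        At0tL : A (t i0) (t iL) ≡ true
        At0tL = A-sym-true (cycle-adj c bt iL i0 cL0)
        At1t2 : A (t i1) (t i2) ≡ true
        At1t2 = cycle-adj c bt i1 i2 c12
        At1s1 : A (t i1) (s i1) ≡ true
        At1s1 = copyVertex-rung c bt bs i1 nts
        AtLsL : A (t iL) (s iL) ≡ true
        AtLsL = copyVertex-rung c bt bs iL nts
        s-inj : ∀ {i j} → i ≢ j → s i ≢ s j
        s-inj ne = copyVertex-injective c bs bs _ _ (inj₂ ne)
        t-inj : ∀ {i j} → i ≢ j → t i ≢ t j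
        t-inj ne = copyVertex-injective c bt bt _ _ (inj₂ ne)
        s≢t : ∀ i j → s i ≢ t j
        s≢t i j = copyVertex-injective c bs bt i j (inj₁ nst)
        t≢s : ∀ i j → t i ≢ s j
        t≢s i j = copyVertex-injective c bt bs i j (inj₁ nts)

        rung-from-s : Ratio≤ 16 31 (delAll (t i0 ∷ s i0 ∷ []) U) U
        rung-from-s = relax 16 31
          (stepT-outside-exposed (t i0) (s i0 ∷ []) (copy-∈ bt i0) (t≢s i0 i0 ∷ [])
             (outside-after bt i0 bs i0 (s i0 ∷ []) (here refl)) (exposed-after bt i0 bs (s i0 ∷ []) (here refl)) ⨾
           stepT (s i0) [] (copy-∈ bs i0) [])

        rung-from-t : Ratio≤ 16 31 (delAll (s i0 ∷ t i0 ∷ []) U) U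
        rung-from-t = relax 16 31
          (stepT-outside-exposed (s i0) (t i0 ∷ []) (copy-∈ bs i0) (s≢t i0 i0 ∷ [])
             (outside-after bs i0 bt i0 (t i0 ∷ []) (here refl)) (exposed-after bs i0 bt (t i0 ∷ []) (here refl)) ⨾
           stepT (t i0) [] (copy-∈ bt i0) [])

        s₀-closed-nbhd : Ratio≤ 9 31 (delAll (s iL ∷ s i1 ∷ t i0 ∷ s i0 ∷ []) U) U
        s₀-closed-nbhd = relax 9 31
          (stepT-outside (s iL) (s i1 ∷ t i0 ∷ s i0 ∷ []) (copy-∈ bs iL) (s-inj (≢-sym n1L) ∷ s≢t iL i0 ∷ s-inj (≢-sym n0L) ∷ [])
             (outside-after bs iL bs i0 (s i1 ∷ t i0 ∷ s i0 ∷ []) (there (there (here refl)))) ⨾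
           stepT-outside (s i1) (t i0 ∷ s i0 ∷ []) (copy-∈ bs i1) (s≢t i1 i0 ∷ s-inj (≢-sym n01) ∷ [])
             (outside-after bs i1 bs i0 (t i0 ∷ s i0 ∷ []) (there (here refl))) ⨾
           rung-from-s)

        t₀-closed-nbhd : Ratio≤ 9 31 (delAll (t iL ∷ t i1 ∷ s i0 ∷ t i0 ∷ []) U) U
        t₀-closed-nbhd = relax 9 31
          (stepT-outside (t iL) (t i1 ∷ s i0 ∷ t i0 ∷ []) (copy-∈ bt iL) (t-inj (≢-sym n1L) ∷ t≢s iL i0 ∷ t-inj (≢-sym n0L) ∷ [])
             (outside-after bt iL bt i0 (t i1 ∷ s i0 ∷ t i0 ∷ []) (there (there (here refl)))) ⨾
           stepT-outside (t i1) (s i0 ∷ t i0 ∷ []) (copy-∈ bt i1) (t≢s i1 i0 ∷ t-inj (≢-sym n01) ∷ [])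
             (outside-after bt i1 bt i0 (s i0 ∷ t i0 ∷ []) (there (here refl))) ⨾
           rung-from-t)

        s₀-in : Bound 9 31 (misWith U (s i0 ∷ []) [])
        s₀-in = bound-in (s i0) [] (s iL ∷ s i1 ∷ t i0 ∷ s i0 ∷ []) (copy-∈ bs i0)
          (inj₂ (inj₂ As0sL) ∷ inj₂ (inj₂ As0s1) ∷ inj₂ (inj₂ As0t0) ∷ inj₁ refl ∷ []) s₀-closed-nbhd

        t₀-in : Bound 9 31 (misWith U (t i0 ∷ []) (s i0 ∷ []))
        t₀-in = bound-in (t i0) (s i0 ∷ []) (t iL ∷ t i1 ∷ s i0 ∷ t i0 ∷ []) (copy-∈ bt i0)
          (inj₂ (inj₂ At0tL) ∷ inj₂ (inj₂ At0t1) ∷ inj₂ (inj₁ (here refl)) ∷ inj₁ refl ∷ []) t₀-closed-nbhd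

        -- If every neighbour of t₀ other than s₀ lies on its own cycle, then s₀, t₀ ∉ S forces
        -- t₁ ∈ S or t_ℓ ∈ S.
        blocked-rung : (∀ y → U y ≡ true → A (t i0) y ≡ true → y ∈ (s i0 ∷ t i1 ∷ t iL ∷ [])) → misIn U * K′ ≤ ΦT U
        blocked-rung nb = bound-total {30} {31}
          (bound-split [] [] (s i0) s₀-in
            (bound-split [] (s i0 ∷ []) (t i0) t₀-in
              (bound-split [] (t i0 ∷ s i0 ∷ []) (t i1) t₁-in
                (bound-split [] (t i1 ∷ t i0 ∷ s i0 ∷ []) (t iL) tL-in
                  (bound-zero [] (t iL ∷ t i1 ∷ t i0 ∷ s i0 ∷ []) (t i0) (copy-∈ bt i0) (there (there (here refl)))
                     (λ y uy ay → sub (nb y uy ay)))))))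
          where
          sub : ∀ {y} → y ∈ (s i0 ∷ t i1 ∷ t iL ∷ []) → y ∈ (t iL ∷ t i1 ∷ t i0 ∷ s i0 ∷ [])
          sub (here e)                 = there (there (there (here e)))
          sub (there (here e))         = there (here e)
          sub (there (there (here e))) = here e
          t₁-in : Bound 6 31 (misWith U (t i1 ∷ []) (t i0 ∷ s i0 ∷ []))
          t₁-in = bound-in (t i1) (t i0 ∷ s i0 ∷ []) (t i2 ∷ s i1 ∷ t i1 ∷ t i0 ∷ s i0 ∷ []) (copy-∈ bt i1)
            (inj₂ (inj₂ At1t2) ∷ inj₂ (inj₂ At1s1) ∷ inj₁ refl ∷ inj₂ (inj₁ (here refl)) ∷ inj₂ (inj₁ (there (here refl))) ∷ [])
            (relax 6 31
              (stepT-outside (t i2) (s i1 ∷ t i1 ∷ t i0 ∷ s i0 ∷ []) (copy-∈ bt i2) (t≢s i2 i1 ∷ t-inj n21 ∷ t-inj n20 ∷ t≢s i2 i0 ∷ [])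
                 (outside-after bt i2 bs i0 (s i1 ∷ t i1 ∷ t i0 ∷ s i0 ∷ []) (there (there (there (here refl))))) ⨾
               stepT-outside-exposed (s i1) (t i1 ∷ t i0 ∷ s i0 ∷ []) (copy-∈ bs i1) (s≢t i1 i1 ∷ s≢t i1 i0 ∷ s-inj (≢-sym n01) ∷ [])
                 (outside-after bs i1 bs i0 (t i1 ∷ t i0 ∷ s i0 ∷ []) (there (there (here refl))))
                 (exposed-after bs i1 bt (t i1 ∷ t i0 ∷ s i0 ∷ []) (here refl)) ⨾
               stepT-outside (t i1) (t i0 ∷ s i0 ∷ []) (copy-∈ bt i1) (t-inj (≢-sym n01) ∷ t≢s i1 i0 ∷ [])
                 (outside-after bt i1 bs i0 (t i0 ∷ s i0 ∷ []) (there (here refl))) ⨾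
               rung-from-s))
          tL-in : Bound 6 31 (misWith U (t iL ∷ []) (t i1 ∷ t i0 ∷ s i0 ∷ []))
          tL-in = bound-in (t iL) (t i1 ∷ t i0 ∷ s i0 ∷ []) (s iL ∷ t iL ∷ t i1 ∷ t i0 ∷ s i0 ∷ []) (copy-∈ bt iL)
            (inj₂ (inj₂ AtLsL) ∷ inj₁ refl ∷ inj₂ (inj₁ (here refl)) ∷ inj₂ (inj₁ (there (here refl))) ∷ inj₂ (inj₁ (there (there (here refl)))) ∷ [])
            (relax 6 31
              (stepT-outside-exposed (s iL) (t iL ∷ t i1 ∷ t i0 ∷ s i0 ∷ []) (copy-∈ bs iL) (s≢t iL iL ∷ s≢t iL i1 ∷ s≢t iL i0 ∷ s-inj (≢-sym n0L) ∷ [])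
                 (outside-after bs iL bs i0 (t iL ∷ t i1 ∷ t i0 ∷ s i0 ∷ []) (there (there (there (here refl)))))
                 (exposed-after bs iL bt (t iL ∷ t i1 ∷ t i0 ∷ s i0 ∷ []) (here refl)) ⨾
               stepT-outside (t iL) (t i1 ∷ t i0 ∷ s i0 ∷ []) (copy-∈ bt iL) (t-inj (≢-sym n1L) ∷ t-inj (≢-sym n0L) ∷ t≢s iL i0 ∷ [])
                 (outside-after bt iL bs i0 (t i1 ∷ t i0 ∷ s i0 ∷ []) (there (there (here refl)))) ⨾
               stepT-outside (t i1) (t i0 ∷ s i0 ∷ []) (copy-∈ bt i1) (t-inj (≢-sym n01) ∷ t≢s i1 i0 ∷ [])
                 (outside-after bt i1 bs i0 (t i0 ∷ s i0 ∷ []) (there (here refl))) ⨾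
               rung-from-s))

        open-rungs : ∀ w w′ → U w ≡ true → A (s i0) w ≡ true → All (w ≢_) (t i0 ∷ s i1 ∷ s iL ∷ []) →
                     U w′ ≡ true → A (t i0) w′ ≡ true → All (w′ ≢_) (s i0 ∷ t i1 ∷ t iL ∷ []) → misIn U * K′ ≤ ΦT U
        open-rungs w w′ uw aw (wt0 ∷ ws1 ∷ wsL ∷ []) uw′ aw′ (w′s0 ∷ w′t1 ∷ w′tL ∷ []) = bound-total {928} {961}
          (bound-split [] [] (s i0)
            (bound-in (s i0) [] (w ∷ s iL ∷ s i1 ∷ t i0 ∷ s i0 ∷ []) (copy-∈ bs i0)
               (inj₂ (inj₂ aw) ∷ inj₂ (inj₂ As0sL) ∷ inj₂ (inj₂ As0s1) ∷ inj₂ (inj₂ As0t0) ∷ inj₁ refl ∷ [])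
               (stepT w (s iL ∷ s i1 ∷ t i0 ∷ s i0 ∷ []) uw (wsL ∷ ws1 ∷ wt0 ∷ A-≢′ aw ∷ []) ⨾ s₀-closed-nbhd))
            (bound-split [] (s i0 ∷ []) (t i0)
              (bound-in (t i0) (s i0 ∷ []) (w′ ∷ t iL ∷ t i1 ∷ s i0 ∷ t i0 ∷ []) (copy-∈ bt i0)
                 (inj₂ (inj₂ aw′) ∷ inj₂ (inj₂ At0tL) ∷ inj₂ (inj₂ At0t1) ∷ inj₂ (inj₁ (here refl)) ∷ inj₁ refl ∷ [])
                 (stepT w′ (t iL ∷ t i1 ∷ s i0 ∷ t i0 ∷ []) uw′ (w′tL ∷ w′t1 ∷ w′s0 ∷ A-≢′ aw′ ∷ []) ⨾ t₀-closed-nbhd))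
              (bound-out (t i0 ∷ s i0 ∷ []) (t i0 ∷ s i0 ∷ []) (t i0) (here refl) (copy-∈ bt i0) (here refl ∷ there (here refl) ∷ [])
                 (relax 496 961 rung-from-s))))

      bound : misIn U * K′ ≤ ΦT U
      bound with any? (NewNbr? U (copyVertex c true i0) (copyVertex c false i0 ∷ copyVertex c true i1 ∷ copyVertex c true iL ∷ []))
      ... | no h = Side.blocked-rung false true (λ ()) (nbrs-listed U (copyVertex c true i0) _ h)
      ... | yes (w′ , uw′ , aw′ , nw′) with any? (NewNbr? U (copyVertex c false i0) (copyVertex c true i0 ∷ copyVertex c false i1 ∷ copyVertex c false iL ∷ []))
      ...   | no h = Side.blocked-rung true false (λ ()) (nbrs-listed U (copyVertex c false i0) _ h)
      ...   | yes (w , uw , aw , nw) = Side.open-rungs false true (λ ()) w w′ uw aw nw uw′ aw′ nw′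

    copy-bound : ∀ M U → size U < M → misIn U * K′ ≤ ΦT U
    copy-bound (suc M) U (s≤s sM) with any? (λ c → intact c U ≟B true)
    ... | no none      = no-intact-copy U (λ c → ≢true⇒≡false (λ e → none (c , e)))
    ... | yes (c , ic) = IntactCopyCases.bound U c ic
                           (λ V V⊆U x ux vx → copy-bound M V (≤-trans (size-< V U x V⊆U ux vx) sM))

  MaximalIndependent⇒MIS : ∀ S → MaximalIndependent Gr S → MIS fullSet (lookup S)
  MaximalIndependent⇒MIS S (indep , maximal) = (λ _ _ → refl) , indep′ , dominating
    where
    indep′ : ∀ x y → lookup S x ≡ true → lookup S y ≡ true → A x y ≡ false
    indep′ x y ex ey = indep x y (lookup⇒[]= x S ex) (lookup⇒[]= y S ey)
    -- If z ∉ S has no neighbour in S, then S ∪ {z} (that is, S with coordinate z flipped) is a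
    -- larger independent set.
    dominating : ∀ z → fullSet z ≡ true → lookup S z ≡ false → ∃ λ y → lookup S y ≡ true × A z y ≡ true
    dominating z _ sz with any? (λ y → (lookup S y ≟B true) ×-dec (A z y ≟B true))
    ... | yes found = found
    ... | no none = ⊥-elim (true≢false (begin
      true                      ≡⟨ cong not sz ⟨
      not (lookup S z)          ≡⟨ lookup-flipAt-same z S ⟨
      lookup (flipAt z S) z     ≡⟨ cong (λ V → lookup V z) (maximal (flipAt z S) indep-flip S⊆flip) ⟩
      lookup S z                ≡⟨ sz ⟩
      false                     ∎))
      where
      open ≡-Reasoning
      in-flip : ∀ x → lookup (flipAt z S) x ≡ true → x ≡ z ⊎ lookup S x ≡ true
      in-flip x e with x ≟F z
      ... | yes p = inj₁ p
      ... | no ne = inj₂ (trans (sym (lookup-flipAt-other z x S ne)) e)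
      z-isolated : ∀ y → lookup S y ≡ true → A z y ≡ false
      z-isolated y sy = ≢true⇒≡false (λ e → none (y , sy , e))
      indep-flip : Independent Gr (flipAt z S)
      indep-flip i j mi mj with in-flip i ([]=⇒lookup mi) | in-flip j ([]=⇒lookup mj)
      ... | inj₁ refl | inj₁ refl = irrefl Gr z
      ... | inj₁ refl | inj₂ sj   = z-isolated j sj
      ... | inj₂ si   | inj₁ refl = trans (A-sym i z) (z-isolated i si)
      ... | inj₂ si   | inj₂ sj   = indep i j (lookup⇒[]= i S si) (lookup⇒[]= j S sj)
      S⊆flip : S ⊆S flipAt z S
      S⊆flip {x} m with x ≟F z
      ... | yes refl = ⊥-elim (true≢false (trans (sym ([]=⇒lookup m)) sz))
      ... | no ne    = lookup⇒[]= x (flipAt z S) (trans (lookup-flipAt-other z x S ne) ([]=⇒lookup m))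

  mis≤misIn : mis Gr ≤ misIn fullSet
  mis≤misIn = begin
    mis Gr                                                     ≡⟨ length-filter≡sum (maximalIndependent? Gr) (allSubsets n) ⟩
    sum (map (χ? ∘ maximalIndependent? Gr) (allSubsets n))     ≡⟨ sum-map-allSubsets n _ ⟩
    sumSubsets n (χ? ∘ maximalIndependent? Gr)                 ≤⟨ sumSubsets-mono n (λ S →
                                                                    subst (χ? (maximalIndependent? Gr S) ≤_) (sym (*-identityʳ _))
                                                                      (χ?-mono (MaximalIndependent⇒MIS S) (maximalIndependent? Gr S) (MIS? fullSet (lookup S)))) ⟩
    misIn fullSet                                              ∎
    where open ≤-Reasoning

rescale : ∀ (M C n f k : ℕ) → M ≤ C → C * (2 ^ n * 9 ^ f * 32 ^ k) ≤ 3 ^ n * 8 ^ f * 31 ^ k →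
          M * (32 ^ k * 2 ^ n) ≤ 31 ^ k * 2 ^ (3 * f) * 3 ^ (n ∸ 2 * f)
rescale M C n f k M≤C bound = *-cancelˡ-≤ (9 ^ f) {{m^n≢0 9 f}} (begin
  9 ^ f * (M * (32 ^ k * 2 ^ n))                  ≤⟨ *-monoʳ-≤ (9 ^ f) (*-monoˡ-≤ (32 ^ k * 2 ^ n) M≤C) ⟩
  9 ^ f * (C * (32 ^ k * 2 ^ n))                  ≡⟨ shuffle₁ (9 ^ f) C (32 ^ k) (2 ^ n) ⟩
  C * (2 ^ n * 9 ^ f * 32 ^ k)                    ≤⟨ bound ⟩
  3 ^ n * 8 ^ f * 31 ^ k                          ≤⟨ *-monoˡ-≤ (31 ^ k) (*-monoˡ-≤ (8 ^ f) 3^n≤) ⟩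
  3 ^ (n ∸ 2 * f) * 9 ^ f * 8 ^ f * 31 ^ k        ≡⟨ cong (λ q → 3 ^ (n ∸ 2 * f) * 9 ^ f * q * 31 ^ k) (^-*-assoc 2 3 f) ⟩
  3 ^ (n ∸ 2 * f) * 9 ^ f * 2 ^ (3 * f) * 31 ^ k  ≡⟨ shuffle₂ (3 ^ (n ∸ 2 * f)) (9 ^ f) (2 ^ (3 * f)) (31 ^ k) ⟩
  9 ^ f * (31 ^ k * 2 ^ (3 * f) * 3 ^ (n ∸ 2 * f)) ∎)
  where
  open ≤-Reasoning
  shuffle₁ : ∀ q c r p → q * (c * (r * p)) ≡ c * (p * q * r)
  shuffle₁ = solve-∀
  shuffle₂ : ∀ t q e u → t * q * e * u ≡ q * (u * e * t)
  shuffle₂ = solve-∀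
  -- 3 ^ (n ∸ 2f) truncates at 0 when 2f > n, so only an inequality holds here.
  3^n≤ : 3 ^ n ≤ 3 ^ (n ∸ 2 * f) * 9 ^ f
  3^n≤ = begin
    3 ^ n                          ≤⟨ ^-monoʳ-≤ 3 (subst (n ≤_) (+-comm (2 * f) (n ∸ 2 * f)) (m≤n+m∸n n (2 * f))) ⟩
    3 ^ (n ∸ 2 * f + 2 * f)        ≡⟨ ^-distribˡ-+-* 3 (n ∸ 2 * f) (2 * f) ⟩
    3 ^ (n ∸ 2 * f) * 3 ^ (2 * f)  ≡⟨ cong (3 ^ (n ∸ 2 * f) *_) (^-*-assoc 3 2 f) ⟨
    3 ^ (n ∸ 2 * f) * 9 ^ f        ∎

-- The m edges and the ℓ rungs u_i v_i of each copy form a matching of size m + ℓ k, indexed through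
-- Fin (m + ℓ k) ≅ Fin m ⊎ Fin ℓ × Fin k.
module PackingMatching {n ℓ k m : ℕ} {G : Graph n} (P : DisjointPacking G ℓ k m) where
  open DisjointPacking P
  open Bounds G using (A; module Matching)

  f : ℕ
  f = m + ℓ * k

  PairIndex : Set
  PairIndex = Fin m ⊎ (Fin ℓ × Fin k)

  index : Fin f → PairIndex
  index i = Sum.map₂ (remQuot k) (splitAt m i)

  unindex : PairIndex → Fin f
  unindex p = join m (ℓ * k) (Sum.map₂ (uncurry combine) p)

  unindex-index : ∀ i → unindex (index i) ≡ i
  unindex-index i with splitAt m i in eq
  ... | inj₁ e = trans (cong (join m (ℓ * k)) (sym eq)) (join-splitAt m (ℓ * k) i)
  ... | inj₂ j rewrite combine-remQuot {ℓ} k j = trans (cong (join m (ℓ * k)) (sym eq)) (join-splitAt m (ℓ * k) i)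

  index-injective : ∀ i j → index i ≡ index j → i ≡ j
  index-injective i j e = trans (sym (unindex-index i)) (trans (cong unindex e) (unindex-index j))

  end : PairIndex → Bool → (Fin k × (Bool × Fin ℓ)) ⊎ (Fin m × Bool)
  end (inj₁ e)       side = inj₂ (e , side)
  end (inj₂ (j , c)) side = inj₁ (c , (side , j))

  end-injective : ∀ p q s s′ → end p s ≡ end q s′ → p ≡ q
  end-injective (inj₁ e)       (inj₁ e′)        s s′ refl = refl
  end-injective (inj₂ (j , c)) (inj₂ (j′ , c′)) s s′ refl = refl

  a b : Fin f → Fin n
  a i = packVertex copy edge (end (index i) false)
  b i = packVertex copy edge (end (index i) true)

  idx : Fin k → Fin ℓ → Fin f
  idx c j = m ↑ʳ combine j c

  index-idx : ∀ c j → index (idx c j) ≡ inj₂ (j , c)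
  index-idx c j rewrite splitAt-↑ʳ m (ℓ * k) (combine j c) | remQuot-combine {ℓ} {k} j c = refl

  rung : ∀ i → A (a i) (b i) ≡ true
  rung i with index i
  ... | inj₁ e       = edge-adj e
  ... | inj₂ (j , c) = copy-hom c (false , j) (true , j) (inj₂ ((λ ()) , refl))

  open Matching f a b rung using (covers; covers-cases)

  covers-end : ∀ i x → covers i x ≡ true → ∃ λ side → x ≡ packVertex copy edge (end (index i) side)
  covers-end i x c with covers-cases i x c
  ... | inj₁ e = false , e
  ... | inj₂ e = true , e

  covers-unique : ∀ x i j → covers i x ≡ true → covers j x ≡ true → i ≡ j
  covers-unique x i j ci cj with covers-end i x ci | covers-end j x cj
  ... | s , e | s′ , e′ = index-injective i j (end-injective _ _ s s′ (vertex-injective _ _ (trans (sym e) e′)))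

  idx-injective : ∀ c i c′ j → idx c i ≡ idx c′ j → c ≡ c′ × i ≡ j
  idx-injective c i c′ j e with trans (sym (index-idx c i)) (trans (cong index e) (index-idx c′ j))
  ... | refl = refl , refl

  copy-side : ∀ c j side → (if side then b (idx c j) else a (idx c j)) ≡ copy c (side , j)
  copy-side c j true  rewrite index-idx c j = refl
  copy-side c j false rewrite index-idx c j = refl

  cycle-adj : ∀ c side i j → CycNext i j →
              A (if side then b (idx c i) else a (idx c i)) (if side then b (idx c j) else a (idx c j)) ≡ true
  cycle-adj c side i j next rewrite copy-side c i side | copy-side c j side =
    copy-hom c (side , i) (side , j) (inj₁ (refl , inj₁ next))

lemma4p3 : (ℓ n k m : ℕ) → 3 ≤ ℓ → (G : Graph n) → DisjointPacking G ℓ k m →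
    mis G * (32 ^ k * 2 ^ n) ≤ 31 ^ k * 2 ^ (3 * (m + ℓ * k)) * 3 ^ (n ∸ 2 * (m + ℓ * k))
lemma4p3 (suc (suc (suc ℓ′))) n k m (s≤s (s≤s (s≤s _))) G P =
  rescale (mis G) (misIn fullSet) n f k mis≤misIn
    (subst (misIn fullSet * (2 ^ n * 9 ^ f * 32 ^ k) ≤_) ΦT-fullSet (copy-bound (suc (size fullSet)) fullSet ≤-refl))
  where
  open Bounds G
  open PackingMatching P
  open CopyBound f a b rung k ℓ′ idx covers-unique idx-injective cycle-adj
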